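{- Let $n$ be a positive integer. Then $$\tau(n+1)\equiv\sum_{\substack{m,r\geq 0\\ n=\frac{m(m+1)}{2}+7\frac{r(r+1)}{2}}}(-1)^{m+r}(2m+1)(2r+1)\pmod 7.$$
   Context: $\tau$ is Ramanujan's tau function: $q\prod_{m=1}^{\infty}(1-q^m)^{24}=\sum_{n\geq1}\tau(n)q^n$. -}

module Defs where

open import Data.Nat as ℕ using (ℕ; zero; suc; _∸_; _≟_)
open import Data.Integer using (ℤ; +_; -_; _+_; _*_; 0ℤ; 1ℤ)
open import Relation.Nullary.Decidable using (does)
open import Data.Bool using (if_then_else_)

Series : Set
Series = ℕ → ℤ

sumTo : ℕ → (ℕ → ℤ) → ℤ
sumTo zero    f = f 0
sumTo (suc k) f = sumTo k f + f (suc k)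

_·S_ : Series → Series → Series
(f ·S g) k = sumTo k (λ i → f i * g (k ∸ i))

oneS : Series
oneS zero    = 1ℤ
oneS (suc _) = 0ℤ

oneMinusQ : ℕ → Series
oneMinusQ m k = oneS k + (if does (k ≟ m) then - 1ℤ else 0ℤ)

powS : Series → ℕ → Series
powS f zero    = oneS
powS f (suc e) = f ·S powS f e

etaProd : ℕ → Series
etaProd zero    = oneS
etaProd (suc N) = powS (oneMinusQ (suc N)) 24 ·S etaProd N

-- Ramanujan's tau: q ∏_{m≥1}(1-q^m)^24 = Σ_{n≥1} τ(n) q^n.
-- The coefficient of q^k in the infinite product equals that of the finite
-- product ∏_{m=1}^{k}, since factors with m > k do not affect degree ≤ k.
τ : ℕ → ℤ
τ zero    = 0ℤ
τ (suc k) = etaProd k k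

tri : ℕ → ℕ
tri m = (m ℕ.* suc m) ℕ./ 2

sgn : ℕ → ℤ
sgn zero          = 1ℤ
sgn (suc zero)    = - 1ℤ
sgn (suc (suc k)) = sgn k

-- Any solution has m ≤ n and r ≤ n (since T(k) ≥ k), so ranging over
-- m, r ∈ {0..n} covers all solutions.
rhsSum : ℕ → ℤ
rhsSum n = sumTo n (λ m → sumTo n (λ r →
  if does (n ≟ tri m ℕ.+ 7 ℕ.* tri r)
  then sgn (m ℕ.+ r) * (+ (2 ℕ.* m ℕ.+ 1)) * (+ (2 ℕ.* r ℕ.+ 1))
  else 0ℤ))

-- Jacobi's identity ∏_{m≥1} (1 - q^m)^3 = Σ_{m≥0} (-1)^m (2m+1) q^{m(m+1)/2} and the congruence
-- (1 - q^m)^7 ≡ 1 - q^{7m} (mod 7) give ∏ (1 - q^m)^24 ≡ ∏ (1 - q^{7m})^3 ∏ (1 - q^m)^3 (mod 7), and the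
-- coefficient of q^n on the right-hand side is the sum in the theorem.
--
-- Jacobi's identity is proved modulo x^n, for an arbitrary power series x, from a finite identity for
-- Gaussian binomials. Write T(j) = j(j+1)/2, extended by T(-j) = T(j-1). The sums
-- B_n = Σ_k (-1)^k x^{T(k-n)} [2n k] and A_n = Σ_k k (-1)^k x^{T(k-n)} [2n k] satisfy one recurrence in n
-- (Pascal's rule applied twice), so B_n = 0 and A_n = (-1)^n (x;x)_n (x;x)_{n-1} for n ≥ 1. Modulo x^n,
-- (x;x)_n A_n ≡ (-1)^n (x;x)_{n-1}^3, while (x;x)_n [2n k] x^{T(k-n)} ≡ x^{T(k-n)}; pairing k = n-1-j with
-- k = n+j then turns (x;x)_n A_n into (-1)^n Σ_{j<n} (-1)^j (2j+1) x^{T(j)}.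

module Submission where

open import Defs
open import Level using (0ℓ)
open import Function using (_∘_)
open import Data.Bool using (true; false; if_then_else_)
open import Data.List using (_∷_; [])
open import Data.Maybe using (Maybe; just; nothing)
open import Data.Product using (_,_)
open import Data.Nat as ℕ using (ℕ; zero; suc; _≤_; _<_; z≤n; s≤s; _∸_; _≟_)
import Data.Nat.Properties as ℕP
import Data.Nat.Tactic.RingSolver as ℕSolver
open import Data.Nat.DivMod using (m*n/n≡m)
open import Data.Integer as ℤ using (ℤ; 0ℤ; 1ℤ; +_; -_; _+_; _*_; _-_)
import Data.Integer.Properties as ℤP
open import Data.Integer.Tactic.RingSolver using (solve-∀)
open import Data.Integer.Divisibility using (_∣_)
open import Data.Integer.Divisibility.Signed using (divides; ∣⇒∣ᵤ)
open import Relation.Nullary using (yes; no; does)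
open import Relation.Nullary.Decidable using (dec-true; dec-false)
open import Relation.Binary.PropositionalEquality as ≡ using (_≡_; _≢_; refl; cong; cong₂)
open import Relation.Binary.Bundles using (Setoid)
open import Algebra.Bundles using (CommutativeRing)
open import Algebra.Structures using (IsCommutativeRing)
open import Algebra.Properties.CommutativeSemigroup ℤP.+-commutativeSemigroup using (interchange)
import Algebra.Solver.Ring
import Algebra.Solver.Ring.AlmostCommutativeRing as ACR
import Algebra.Properties.CommutativeSemiring.Exp as Exp
import Relation.Binary.Reasoning.Setoid as SetoidReasoning
import Relation.Binary.Reasoning.MultiSetoid as MultiSetoidReasoning

module _ where
  open ≡.≡-Reasoning

  sumTo-cong : ∀ k {f g : ℕ → ℤ} → (∀ i → i ≤ k → f i ≡ g i) → sumTo k f ≡ sumTo k g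
  sumTo-cong zero    f≡g = f≡g 0 z≤n
  sumTo-cong (suc k) f≡g =
    cong₂ _+_ (sumTo-cong k (λ i i≤k → f≡g i (ℕP.m≤n⇒m≤1+n i≤k))) (f≡g (suc k) ℕP.≤-refl)

  sumTo-cong-≗ : ∀ k {f g : ℕ → ℤ} → (∀ i → f i ≡ g i) → sumTo k f ≡ sumTo k g
  sumTo-cong-≗ k f≡g = sumTo-cong k (λ i _ → f≡g i)

  sumTo-zero : ∀ k {f : ℕ → ℤ} → (∀ i → i ≤ k → f i ≡ 0ℤ) → sumTo k f ≡ 0ℤ
  sumTo-zero k f≡0 = ≡.trans (sumTo-cong k f≡0) (sumTo-0# k)
    where
    sumTo-0# : ∀ k → sumTo k (λ _ → 0ℤ) ≡ 0ℤ
    sumTo-0# zero    = refl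
    sumTo-0# (suc k) = cong (_+ 0ℤ) (sumTo-0# k)

  sumTo-distrib-+ : ∀ k (f g : ℕ → ℤ) → sumTo k (λ i → f i + g i) ≡ sumTo k f + sumTo k g
  sumTo-distrib-+ zero    f g = refl
  sumTo-distrib-+ (suc k) f g = ≡.trans (cong (_+ (f (suc k) + g (suc k))) (sumTo-distrib-+ k f g))
    (interchange (sumTo k f) (sumTo k g) (f (suc k)) (g (suc k)))

  *-distribˡ-sumTo : ∀ k (c : ℤ) (f : ℕ → ℤ) → c * sumTo k f ≡ sumTo k (λ i → c * f i)
  *-distribˡ-sumTo zero    c f = refl
  *-distribˡ-sumTo (suc k) c f = ≡.trans (ℤP.*-distribˡ-+ c (sumTo k f) (f (suc k)))
    (cong (_+ (c * f (suc k))) (*-distribˡ-sumTo k c f))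

  *-distribʳ-sumTo : ∀ k (c : ℤ) (f : ℕ → ℤ) → sumTo k f * c ≡ sumTo k (λ i → f i * c)
  *-distribʳ-sumTo k c f = begin
    sumTo k f * c              ≡⟨ ℤP.*-comm (sumTo k f) c ⟩
    c * sumTo k f              ≡⟨ *-distribˡ-sumTo k c f ⟩
    sumTo k (λ i → c * f i)    ≡⟨ sumTo-cong-≗ k (λ i → ℤP.*-comm c (f i)) ⟩
    sumTo k (λ i → f i * c)    ∎

  sumTo-suc : ∀ k (f : ℕ → ℤ) → sumTo (suc k) f ≡ f 0 + sumTo k (λ i → f (suc i))
  sumTo-suc zero    f = refl
  sumTo-suc (suc k) f = ≡.trans (cong (_+ f (suc (suc k))) (sumTo-suc k f)) (ℤP.+-assoc (f 0) _ _)

  sumTo-reverse : ∀ k (f : ℕ → ℤ) → sumTo k f ≡ sumTo k (λ i → f (k ∸ i))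
  sumTo-reverse zero    f = refl
  sumTo-reverse (suc k) f = begin
    sumTo k f + f (suc k)                       ≡⟨ cong (_+ f (suc k)) (sumTo-reverse k f) ⟩
    sumTo k (λ i → f (k ∸ i)) + f (suc k)       ≡⟨ ℤP.+-comm _ (f (suc k)) ⟩
    f (suc k) + sumTo k (λ i → f (k ∸ i))       ≡⟨ sumTo-suc k (λ i → f (suc k ∸ i)) ⟨
    sumTo (suc k) (λ i → f (suc k ∸ i))         ∎

  sumTo-comm : ∀ a b (f : ℕ → ℕ → ℤ) →
    sumTo a (λ i → sumTo b (λ j → f i j)) ≡ sumTo b (λ j → sumTo a (λ i → f i j))
  sumTo-comm zero    b f = refl
  sumTo-comm (suc a) b f = ≡.trans (cong (_+ sumTo b (f (suc a))) (sumTo-comm a b f))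
    (≡.sym (sumTo-distrib-+ b (λ j → sumTo a (λ i → f i j)) (f (suc a))))

  sumTo-*-sumTo : ∀ N (a b : ℕ → ℤ) → sumTo N a * sumTo N b ≡ sumTo N (λ m → sumTo N (λ r → a r * b m))
  sumTo-*-sumTo N a b = ≡.trans (*-distribˡ-sumTo N (sumTo N a) b) (sumTo-cong-≗ N (λ m → *-distribʳ-sumTo N (b m) a))

  sumTo-triangle : ∀ k (f : ℕ → ℕ → ℤ) →
    sumTo k (λ i → sumTo i (f i)) ≡ sumTo k (λ j → sumTo (k ∸ j) (λ l → f (j ℕ.+ l) j))
  sumTo-triangle zero    f = refl
  sumTo-triangle (suc k) f = begin
    sumTo k (λ i → sumTo i (f i)) + sumTo (suc k) (f (suc k))
      ≡⟨ cong (_+ sumTo (suc k) (f (suc k))) (sumTo-triangle k f) ⟩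
    sumTo k inner + (sumTo k (f (suc k)) + f (suc k) (suc k))
      ≡⟨ ℤP.+-assoc (sumTo k inner) _ _ ⟨
    (sumTo k inner + sumTo k (f (suc k))) + f (suc k) (suc k)
      ≡⟨ cong (_+ f (suc k) (suc k)) (sumTo-distrib-+ k inner (f (suc k))) ⟨
    sumTo k (λ j → inner j + f (suc k) j) + f (suc k) (suc k)
      ≡⟨ cong₂ _+_ (sumTo-cong k extend) (cong (λ i → f i (suc k)) (ℕP.+-identityʳ (suc k))) ⟨
    sumTo k (λ j → sumTo (suc k ∸ j) (λ l → f (j ℕ.+ l) j)) + f (suc k ℕ.+ 0) (suc k)
      ≡⟨ cong (λ n → sumTo k outer + sumTo n (λ l → f (suc k ℕ.+ l) (suc k))) (ℕP.n∸n≡0 k) ⟨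
    sumTo (suc k) (λ j → sumTo (suc k ∸ j) (λ l → f (j ℕ.+ l) j))
      ∎
    where
    outer inner : ℕ → ℤ
    outer j = sumTo (suc k ∸ j) (λ l → f (j ℕ.+ l) j)
    inner j = sumTo (k ∸ j) (λ l → f (j ℕ.+ l) j)
    extend : ∀ j → j ≤ k → sumTo (suc k ∸ j) (λ l → f (j ℕ.+ l) j) ≡ inner j + f (suc k) j
    extend j j≤k rewrite ℕP.+-∸-assoc 1 j≤k =
      cong (λ i → inner j + f i j) (≡.trans (ℕP.+-suc j (k ∸ j)) (cong suc (ℕP.m+[n∸m]≡n j≤k)))

  sumTo-extend : ∀ a b {f : ℕ → ℤ} → a ≤ b → (∀ i → a < i → f i ≡ 0ℤ) → sumTo b f ≡ sumTo a f
  sumTo-extend a b {f} a≤b f≡0 with ℕP.m≤n⇒∃[o]m+o≡n a≤b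
  ... | d , refl = go d
    where
    go : ∀ d → sumTo (a ℕ.+ d) f ≡ sumTo a f
    go zero    = cong (λ n → sumTo n f) (ℕP.+-identityʳ a)
    go (suc d) rewrite ℕP.+-suc a d =
      ≡.trans (cong₂ _+_ (go d) (f≡0 _ (s≤s (ℕP.m≤m+n a d)))) (ℤP.+-identityʳ _)

  sumTo-split : ∀ a b (f : ℕ → ℤ) → sumTo (b ℕ.+ suc a) f ≡ sumTo a f + sumTo b (λ j → f (suc a ℕ.+ j))
  sumTo-split a zero    f = cong (λ i → sumTo a f + f i) (≡.sym (ℕP.+-identityʳ (suc a)))
  sumTo-split a (suc b) f = begin
    sumTo (b ℕ.+ suc a) f + f (suc (b ℕ.+ suc a))
      ≡⟨ cong (_+ f (suc (b ℕ.+ suc a))) (sumTo-split a b f) ⟩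
    sumTo a f + sumTo b (λ j → f (suc a ℕ.+ j)) + f (suc (b ℕ.+ suc a))
      ≡⟨ ℤP.+-assoc (sumTo a f) _ _ ⟩
    sumTo a f + (sumTo b (λ j → f (suc a ℕ.+ j)) + f (suc (b ℕ.+ suc a)))
      ≡⟨ cong (λ i → sumTo a f + (sumTo b (λ j → f (suc a ℕ.+ j)) + f i)) (ℕP.+-comm (suc b) (suc a)) ⟩
    sumTo a f + sumTo (suc b) (λ j → f (suc a ℕ.+ j)) ∎

  δ : ℕ → ℕ → ℤ
  δ i a = if does (i ≟ a) then 1ℤ else 0ℤ

  if≟≡δ* : ∀ i a c → (if does (i ≟ a) then c else 0ℤ) ≡ δ i a * c
  if≟≡δ* i a c with does (i ≟ a)
  ... | true  = ≡.sym (ℤP.*-identityˡ c)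
  ... | false = ≡.sym (ℤP.*-zeroˡ c)

  δ-≡ : ∀ i a → i ≡ a → δ i a ≡ 1ℤ
  δ-≡ i a i≡a rewrite dec-true (i ≟ a) i≡a = refl

  δ-≢ : ∀ i a → i ≢ a → δ i a ≡ 0ℤ
  δ-≢ i a i≢a rewrite dec-false (i ≟ a) i≢a = refl

  δ-∸ : ∀ {N a} b → a ≤ N → δ (N ∸ a) b ≡ δ N (b ℕ.+ a)
  δ-∸ {N} {a} b a≤N with (N ∸ a) ≟ b
  ... | yes refl = ≡.trans (δ-≡ (N ∸ a) (N ∸ a) refl) (≡.sym (δ-≡ N _ (≡.sym (ℕP.m∸n+n≡m a≤N))))
  ... | no N∸a≢b = ≡.trans (δ-≢ _ b N∸a≢b) (≡.sym (δ-≢ N (b ℕ.+ a) N≢b+a))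
    where
    N≢b+a : N ≢ b ℕ.+ a
    N≢b+a N≡b+a = N∸a≢b (≡.trans (cong (_∸ a) N≡b+a) (ℕP.m+n∸n≡m b a))

  sumTo-δ-< : ∀ N a (g : ℕ → ℤ) → N < a → sumTo N (λ i → δ i a * g i) ≡ 0ℤ
  sumTo-δ-< N a g N<a = sumTo-zero N (λ i i≤N →
    ≡.trans (cong (_* g i) (δ-≢ i a (ℕP.<⇒≢ (ℕP.≤-<-trans i≤N N<a)))) (ℤP.*-zeroˡ (g i)))

  sumTo-δ-≤ : ∀ N a (g : ℕ → ℤ) → a ≤ N → sumTo N (λ i → δ i a * g i) ≡ g a
  sumTo-δ-≤ zero    zero g _ = ℤP.*-identityˡ (g 0)
  sumTo-δ-≤ (suc N) a  g a≤1+N with a ≟ suc N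
  ... | yes refl = begin
    sumTo N (λ i → δ i a * g i) + δ a a * g a
      ≡⟨ cong₂ _+_ (sumTo-δ-< N a g ℕP.≤-refl) (cong (_* g a) (δ-≡ a a refl)) ⟩
    0ℤ + 1ℤ * g a
      ≡⟨ ℤP.+-identityˡ _ ⟩
    1ℤ * g a
      ≡⟨ ℤP.*-identityˡ (g a) ⟩
    g a
      ∎
  ... | no a≢1+N = begin
    sumTo N (λ i → δ i a * g i) + δ (suc N) a * g (suc N)
      ≡⟨ cong₂ _+_ (sumTo-δ-≤ N a g (ℕP.≤-pred (ℕP.≤∧≢⇒< a≤1+N a≢1+N)))
                   (cong (_* g (suc N)) (δ-≢ (suc N) a (a≢1+N ∘ ≡.sym))) ⟩
    g a + 0ℤ * g (suc N)
      ≡⟨ cong (_+_ (g a)) (ℤP.*-zeroˡ (g (suc N))) ⟩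
    g a + 0ℤ
      ≡⟨ ℤP.+-identityʳ (g a) ⟩
    g a ∎

  sgn-suc : ∀ k → sgn (suc k) ≡ - sgn k
  sgn-suc zero          = refl
  sgn-suc (suc zero)    = refl
  sgn-suc (suc (suc k)) = sgn-suc k

  sgn-square : ∀ k → sgn k * sgn k ≡ 1ℤ
  sgn-square zero          = refl
  sgn-square (suc zero)    = refl
  sgn-square (suc (suc k)) = sgn-square k

  sgn-+ : ∀ a b → sgn (a ℕ.+ b) ≡ sgn a * sgn b
  sgn-+ zero    b = ≡.sym (ℤP.*-identityˡ (sgn b))
  sgn-+ (suc a) b = begin
    sgn (suc (a ℕ.+ b))   ≡⟨ sgn-suc (a ℕ.+ b) ⟩
    - sgn (a ℕ.+ b)       ≡⟨ cong -_ (sgn-+ a b) ⟩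
    - (sgn a * sgn b)     ≡⟨ ℤP.neg-distribˡ-* (sgn a) (sgn b) ⟩
    - sgn a * sgn b       ≡⟨ cong (_* sgn b) (sgn-suc a) ⟨
    sgn (suc a) * sgn b   ∎

  sgn-∸ : ∀ {N j} → j ≤ N → sgn (N ∸ j) ≡ sgn N * sgn j
  sgn-∸ {N} {j} j≤N = begin
    sgn (N ∸ j)                        ≡⟨ ℤP.*-identityʳ _ ⟨
    sgn (N ∸ j) * 1ℤ                   ≡⟨ cong (sgn (N ∸ j) *_) (sgn-square j) ⟨
    sgn (N ∸ j) * (sgn j * sgn j)      ≡⟨ ℤP.*-assoc (sgn (N ∸ j)) (sgn j) (sgn j) ⟨
    sgn (N ∸ j) * sgn j * sgn j        ≡⟨ cong (_* sgn j) (sgn-+ (N ∸ j) j) ⟨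
    sgn (N ∸ j ℕ.+ j) * sgn j          ≡⟨ cong (λ n → sgn n * sgn j) (ℕP.m∸n+n≡m j≤N) ⟩
    sgn N * sgn j                      ∎

module _ where
  open ℕP.≤-Reasoning

  triangular : ℕ → ℕ
  triangular zero    = 0
  triangular (suc m) = triangular m ℕ.+ suc m

  tri≡triangular : ∀ m → tri m ≡ triangular m
  tri≡triangular m = ≡.trans (cong (ℕ._/ 2) (m[1+m]≡2T m)) (m*n/n≡m (triangular m) 2)
    where
    m[1+m]≡2T : ∀ m → m ℕ.* suc m ≡ triangular m ℕ.* 2
    m[1+m]≡2T zero    = refl
    m[1+m]≡2T (suc m) = begin-equality
      suc m ℕ.* suc (suc m)                    ≡⟨ ℕSolver.solve (m ∷ []) ⟩
      m ℕ.* suc m ℕ.+ suc m ℕ.* 2              ≡⟨ cong (ℕ._+ suc m ℕ.* 2) (m[1+m]≡2T m) ⟩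
      triangular m ℕ.* 2 ℕ.+ suc m ℕ.* 2       ≡⟨ ℕP.*-distribʳ-+ 2 (triangular m) (suc m) ⟨
      triangular (suc m) ℕ.* 2                 ∎

  double : ℕ → ℕ
  double zero    = zero
  double (suc n) = suc (suc (double n))

  double≡n+n : ∀ n → double n ≡ n ℕ.+ n
  double≡n+n zero    = refl
  double≡n+n (suc n) = cong suc (≡.trans (cong suc (double≡n+n n)) (≡.sym (ℕP.+-suc n n)))

  -- exponent n k = T(k - n), with T extended to negative arguments by T(-j) = T(j - 1).
  exponent : ℕ → ℕ → ℕ
  exponent zero    k       = triangular k
  exponent (suc n) zero    = triangular n
  exponent (suc n) (suc k) = exponent n k

  exponent-zero : ∀ n → exponent n 0 ℕ.+ n ≡ triangular n
  exponent-zero zero    = refl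
  exponent-zero (suc n) = refl

  exponent-suc : ∀ n k → exponent n (suc k) ℕ.+ n ≡ exponent n k ℕ.+ suc k
  exponent-suc zero    k       = ℕP.+-identityʳ _
  exponent-suc (suc n) zero    =
    ≡.trans (ℕP.+-suc (exponent n 0) n) (≡.trans (cong suc (exponent-zero n)) (ℕP.+-comm 1 (triangular n)))
  exponent-suc (suc n) (suc k) = ≡.trans (ℕP.+-suc (exponent n (suc k)) n)
    (≡.trans (cong suc (exponent-suc n k)) (≡.sym (ℕP.+-suc (exponent n k) (suc k))))

  exponent-reflect : ∀ n k → k ≤ double n → exponent n k ℕ.+ suc n ≡ exponent n (suc k) ℕ.+ (double n ∸ k)
  exponent-reflect n k k≤2n = reflect (exponent-suc n k) (≡.trans (ℕP.m∸n+n≡m k≤2n) (double≡n+n n))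
    where
    reflect : ∀ {e e′ d} → e′ ℕ.+ n ≡ e ℕ.+ suc k → d ℕ.+ k ≡ n ℕ.+ n → e ℕ.+ suc n ≡ e′ ℕ.+ d
    reflect {e} {e′} {d} e′+n≡e+1+k d+k≡n+n = ℕP.+-cancelʳ-≡ (k ℕ.+ n) _ _ (begin-equality
      e ℕ.+ suc n ℕ.+ (k ℕ.+ n)      ≡⟨ ℕSolver.solve (e ∷ n ∷ k ∷ []) ⟩
      (e ℕ.+ suc k) ℕ.+ (n ℕ.+ n)    ≡⟨ cong₂ ℕ._+_ (≡.sym e′+n≡e+1+k) (≡.sym d+k≡n+n) ⟩
      (e′ ℕ.+ n) ℕ.+ (d ℕ.+ k)       ≡⟨ ℕSolver.solve (e′ ∷ n ∷ d ∷ k ∷ []) ⟩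
      e′ ℕ.+ d ℕ.+ (k ℕ.+ n)         ∎)

  n≤triangular : ∀ j → j ≤ triangular j
  n≤triangular zero    = ℕ.z≤n
  n≤triangular (suc j) = ℕP.m≤n+m (suc j) (triangular j)

  n≤exponent+1+k : ∀ n k → n ≤ exponent n k ℕ.+ suc k
  n≤exponent+1+k zero    k       = ℕ.z≤n
  n≤exponent+1+k (suc n) zero    = ℕP.≤-trans (ℕ.s≤s (n≤triangular n)) (ℕP.≤-reflexive (ℕP.+-comm 1 (triangular n)))
  n≤exponent+1+k (suc n) (suc k) =
    ℕP.≤-trans (ℕ.s≤s (n≤exponent+1+k n k)) (ℕP.≤-reflexive (≡.sym (ℕP.+-suc (exponent n k) (suc k))))

  k≤exponent+n : ∀ n k → k ≤ exponent n k ℕ.+ n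
  k≤exponent+n zero    k       = ℕP.≤-trans (n≤triangular k) (ℕP.m≤m+n _ 0)
  k≤exponent+n (suc n) zero    = ℕ.z≤n
  k≤exponent+n (suc n) (suc k) =
    ℕP.≤-trans (ℕ.s≤s (k≤exponent+n n k)) (ℕP.≤-reflexive (≡.sym (ℕP.+-suc (exponent n k) n)))

  n≤exponent+1+[double∸k] : ∀ n k → k ≤ double n → n ≤ exponent n k ℕ.+ suc (double n ∸ k)
  n≤exponent+1+[double∸k] n k k≤2n = ℕP.+-cancelʳ-≤ n n _ (begin
    n ℕ.+ n                                  ≡⟨ double≡n+n n ⟨
    double n                                 ≡⟨ ℕP.m∸n+n≡m k≤2n ⟨
    (double n ∸ k) ℕ.+ k                     ≤⟨ ℕP.+-monoʳ-≤ (double n ∸ k) (k≤exponent+n n k) ⟩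
    (double n ∸ k) ℕ.+ (exponent n k ℕ.+ n)  ≤⟨ rearrange (double n ∸ k) (exponent n k) ⟩
    exponent n k ℕ.+ suc (double n ∸ k) ℕ.+ n ∎)
    where
    rearrange : ∀ d e → d ℕ.+ (e ℕ.+ n) ≤ e ℕ.+ suc d ℕ.+ n
    rearrange d e = ℕP.≤-trans (ℕP.n≤1+n _) (ℕP.≤-reflexive (ℕSolver.solve (d ∷ e ∷ n ∷ [])))

  double∸n≡n : ∀ n → double n ∸ n ≡ n
  double∸n≡n n = ≡.trans (cong (_∸ n) (double≡n+n n)) (ℕP.m+n∸n≡m n n)

  exponent-below : ∀ i j → exponent (suc (i ℕ.+ j)) i ≡ triangular j
  exponent-below zero    j = refl
  exponent-below (suc i) j = exponent-below i j

  exponent-above : ∀ n j → exponent n (n ℕ.+ j) ≡ triangular j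
  exponent-above zero    j = refl
  exponent-above (suc n) j = exponent-above n j

-- Formal power series over ℤ

module _ where
  open ≡.≡-Reasoning

  infix 4 _≈_
  record _≈_ (f g : Series) : Set where
    constructor mk≈
    field coeff : ∀ k → f k ≡ g k
  open _≈_ public

  -- Opaque, so that unification treats the ring operations as rigid symbols.
  opaque
    infixl 6 _+S_
    _+S_ : Series → Series → Series
    (f +S g) k = f k + g k

    infix 8 -S_
    -S_ : Series → Series
    (-S f) k = - f k

    infixl 7 _*S_
    _*S_ : Series → Series → Series
    _*S_ = _·S_

  constS : ℤ → Series
  constS c zero    = c
  constS c (suc _) = 0ℤ

  -- Defined through constS so that they agree definitionally with the ring solver's constants con c.
  0S 1S : Series
  0S = constS 0ℤ
  1S = constS 1ℤ

  0S-coeff : ∀ k → 0S k ≡ 0ℤ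
  0S-coeff zero    = refl
  0S-coeff (suc k) = refl

  ·S-cong : ∀ {f f′ g g′} → f ≈ f′ → g ≈ g′ → f ·S g ≈ f′ ·S g′
  ·S-cong f≈f′ g≈g′ = mk≈ λ k → sumTo-cong-≗ k (λ i → cong₂ _*_ (coeff f≈f′ i) (coeff g≈g′ (k ∸ i)))

  ·S-comm : ∀ f g → f ·S g ≈ g ·S f
  ·S-comm f g = mk≈ λ k → begin
    sumTo k (λ i → f i * g (k ∸ i))
      ≡⟨ sumTo-reverse k _ ⟩
    sumTo k (λ i → f (k ∸ i) * g (k ∸ (k ∸ i)))
      ≡⟨ sumTo-cong k (λ i i≤k → cong (λ j → f (k ∸ i) * g j) (ℕP.m∸[m∸n]≡n i≤k)) ⟩
    sumTo k (λ i → f (k ∸ i) * g i)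
      ≡⟨ sumTo-cong-≗ k (λ i → ℤP.*-comm (f (k ∸ i)) (g i)) ⟩
    sumTo k (λ i → g i * f (k ∸ i))
      ∎

  ·S-identityˡ : ∀ f → 1S ·S f ≈ f
  ·S-identityˡ f = mk≈ λ where
    zero    → ℤP.*-identityˡ (f 0)
    (suc k) → begin
      sumTo (suc k) (λ i → 1S i * f (suc k ∸ i))
        ≡⟨ sumTo-suc k _ ⟩
      1ℤ * f (suc k) + sumTo k (λ i → 0ℤ * f (k ∸ i))
        ≡⟨ cong₂ _+_ (ℤP.*-identityˡ (f (suc k))) (sumTo-zero k (λ _ _ → refl)) ⟩
      f (suc k) + 0ℤ
        ≡⟨ ℤP.+-identityʳ _ ⟩
      f (suc k)
        ∎

  ·S-assoc : ∀ f g h → (f ·S g) ·S h ≈ f ·S (g ·S h)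
  ·S-assoc f g h = mk≈ assoc
    where
    reindex : ∀ k j l → f j * g (j ℕ.+ l ∸ j) * h (k ∸ (j ℕ.+ l)) ≡ f j * (g l * h (k ∸ j ∸ l))
    reindex k j l rewrite ℕP.m+n∸m≡n j l | ℕP.∸-+-assoc k j l = ℤP.*-assoc (f j) (g l) _

    assoc : ∀ k → ((f ·S g) ·S h) k ≡ (f ·S (g ·S h)) k
    assoc k = begin
      sumTo k (λ i → sumTo i (λ j → f j * g (i ∸ j)) * h (k ∸ i))
        ≡⟨ sumTo-cong-≗ k (λ i → *-distribʳ-sumTo i (h (k ∸ i)) _) ⟩
      sumTo k (λ i → sumTo i (λ j → f j * g (i ∸ j) * h (k ∸ i)))
        ≡⟨ sumTo-triangle k (λ i j → f j * g (i ∸ j) * h (k ∸ i)) ⟩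
      sumTo k (λ j → sumTo (k ∸ j) (λ l → f j * g (j ℕ.+ l ∸ j) * h (k ∸ (j ℕ.+ l))))
        ≡⟨ sumTo-cong-≗ k (λ j → sumTo-cong-≗ (k ∸ j) (reindex k j)) ⟩
      sumTo k (λ j → sumTo (k ∸ j) (λ l → f j * (g l * h (k ∸ j ∸ l))))
        ≡⟨ sumTo-cong-≗ k (λ j → *-distribˡ-sumTo (k ∸ j) (f j) _) ⟨
      sumTo k (λ j → f j * sumTo (k ∸ j) (λ l → g l * h (k ∸ j ∸ l)))
        ∎

  opaque
    unfolding _+S_ -S_ _*S_

    +S-coeff : ∀ f g k → (f +S g) k ≡ f k + g k
    +S-coeff f g k = refl

    -S-coeff : ∀ f k → (-S f) k ≡ - f k
    -S-coeff f k = refl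

    *S-coeff : ∀ f g k → (f *S g) k ≡ (f ·S g) k
    *S-coeff f g k = refl

    ·S-distribʳ : ∀ f g h → (g +S h) ·S f ≈ g ·S f +S h ·S f
    ·S-distribʳ f g h = mk≈ λ k →
      ≡.trans (sumTo-cong-≗ k (λ i → ℤP.*-distribʳ-+ (f (k ∸ i)) (g i) (h i))) (sumTo-distrib-+ k _ _)

    series-isCommutativeRing : IsCommutativeRing _≈_ _+S_ _*S_ -S_ 0S 1S
    series-isCommutativeRing = record
      { isRing = record
        { +-isAbelianGroup = record
          { isGroup = record
            { isMonoid = record
              { isSemigroup = record
                { isMagma = record
                  { isEquivalence = record
                    { refl = mk≈ λ _ → refl
                    ; sym = λ f≈g → mk≈ λ k → ≡.sym (coeff f≈g k)
                    ; trans = λ f≈g g≈h → mk≈ λ k → ≡.trans (coeff f≈g k) (coeff g≈h k) }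
                  ; ∙-cong = λ f≈f′ g≈g′ → mk≈ λ k → cong₂ _+_ (coeff f≈f′ k) (coeff g≈g′ k) }
                ; assoc = λ f g h → mk≈ λ k → ℤP.+-assoc (f k) (g k) (h k) }
              ; identity = (λ f → mk≈ λ k → ≡.trans (cong (_+ f k) (0S-coeff k)) (ℤP.+-identityˡ (f k)))
                         , (λ f → mk≈ λ k → ≡.trans (cong (_+_ (f k)) (0S-coeff k)) (ℤP.+-identityʳ (f k))) }
            ; inverse = (λ f → mk≈ λ k → ≡.trans (ℤP.+-inverseˡ (f k)) (≡.sym (0S-coeff k)))
                      , (λ f → mk≈ λ k → ≡.trans (ℤP.+-inverseʳ (f k)) (≡.sym (0S-coeff k)))
            ; ⁻¹-cong = λ f≈g → mk≈ λ k → cong -_ (coeff f≈g k) }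
          ; comm = λ f g → mk≈ λ k → ℤP.+-comm (f k) (g k) }
        ; *-cong = ·S-cong
        ; *-assoc = ·S-assoc
        ; *-identity = ·S-identityˡ , λ f → mk≈ λ k → ≡.trans (coeff (·S-comm f 1S) k) (coeff (·S-identityˡ f) k)
        ; distrib = (λ f g h → mk≈ λ k → ≡.trans (coeff (·S-comm f (g +S h)) k)
                      (≡.trans (coeff (·S-distribʳ f g h) k) (cong₂ _+_ (coeff (·S-comm g f) k) (coeff (·S-comm h f) k))))
                  , ·S-distribʳ }
      ; *-comm = ·S-comm }

    constS-* : ∀ a b → constS (a * b) ≈ constS a *S constS b
    constS-* a b = mk≈ λ where
      zero    → refl
      (suc k) → ≡.sym (begin
        sumTo (suc k) (λ i → constS a i * constS b (suc k ∸ i))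
          ≡⟨ sumTo-suc k _ ⟩
        a * 0ℤ + sumTo k (λ i → 0ℤ * constS b (k ∸ i))
          ≡⟨ cong₂ _+_ (ℤP.*-zeroʳ a) (sumTo-zero k (λ _ _ → refl)) ⟩
        0ℤ
          ∎)

    constS-+ : ∀ a b → constS (a + b) ≈ constS a +S constS b
    constS-+ a b = mk≈ λ { zero → refl ; (suc k) → refl }

    constS-neg : ∀ a → constS (- a) ≈ -S constS a
    constS-neg a = mk≈ λ { zero → refl ; (suc k) → refl }

  seriesRing : CommutativeRing 0ℓ 0ℓ
  seriesRing = record { isCommutativeRing = series-isCommutativeRing }

  constS-morphism : ACR._-Raw-AlmostCommutative⟶_ (CommutativeRing.rawRing ℤP.+-*-commutativeRing) (ACR.fromCommutativeRing seriesRing)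
  constS-morphism = record
    { ⟦_⟧ = constS
    ; +-homo = constS-+
    ; *-homo = constS-*
    ; -‿homo = constS-neg
    ; 0-homo = mk≈ λ _ → refl
    ; 1-homo = mk≈ λ _ → refl
    }

  constS-≟ : ∀ a b → Maybe (constS a ≈ constS b)
  constS-≟ a b with a ℤP.≟ b
  ... | yes refl = just (mk≈ λ _ → refl)
  ... | no _     = nothing

  open Algebra.Solver.Ring _ (ACR.fromCommutativeRing seriesRing) constS-morphism constS-≟ public

open CommutativeRing seriesRing
  renaming (refl to ≈-refl; sym to ≈-sym; trans to ≈-trans)
  using (setoid; +-cong; +-congˡ; +-congʳ; -‿cong; *-cong; *-congˡ; *-congʳ; *-assoc; *-comm; *-identityˡ; *-identityʳ;
         zeroˡ; zeroʳ; +-identityˡ; +-identityʳ; distribˡ; distribʳ)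
open Exp (CommutativeRing.commutativeSemiring seriesRing) using (_^_; ^-homo-*; ^-assocʳ; ^-congˡ; ^-congʳ; ^-distrib-*)
module ≈-Reasoning = SetoidReasoning setoid

-- Congruences modulo a power series

module _ where
  open ≈-Reasoning

  infix 4 _≈_[mod_]
  record _≈_[mod_] (f g x : Series) : Set where
    constructor _,_
    field
      quotient : Series
      difference : f ≈ g +S x *S quotient
  open _≈_[mod_] public

  module _ {x : Series} where

    ≈⇒≈[mod] : ∀ {f g} → f ≈ g → f ≈ g [mod x ]
    ≈⇒≈[mod] {f} {g} f≈g = 0S , (begin
      f              ≈⟨ f≈g ⟩
      g              ≈⟨ solve 2 (λ g x → g := g :+ x :* con 0ℤ) ≈-refl g x ⟩
      g +S x *S 0S   ∎)

    [mod]-refl : ∀ {f} → f ≈ f [mod x ]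
    [mod]-refl = ≈⇒≈[mod] ≈-refl

    [mod]-sym : ∀ {f g} → f ≈ g [mod x ] → g ≈ f [mod x ]
    [mod]-sym {f} {g} (h , f≈g+xh) = -S h , (begin
      g                              ≈⟨ solve 3 (λ g x h → g := (g :+ x :* h) :+ x :* (:- h)) ≈-refl g x h ⟩
      (g +S x *S h) +S x *S (-S h)   ≈⟨ +-congʳ f≈g+xh ⟨
      f +S x *S (-S h)               ∎)

    [mod]-trans : ∀ {f g u} → f ≈ g [mod x ] → g ≈ u [mod x ] → f ≈ u [mod x ]
    [mod]-trans {f} {g} {u} (h , f≈g+xh) (h′ , g≈u+xh′) = h′ +S h , (begin
      f                          ≈⟨ f≈g+xh ⟩
      g +S x *S h                ≈⟨ +-congʳ g≈u+xh′ ⟩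
      (u +S x *S h′) +S x *S h   ≈⟨ solve 4 (λ u x h h′ → (u :+ x :* h′) :+ x :* h := u :+ x :* (h′ :+ h)) ≈-refl u x h h′ ⟩
      u +S x *S (h′ +S h)        ∎)

    [mod]-resp : ∀ {f f′ g g′} → f ≈ f′ → g ≈ g′ → f ≈ g [mod x ] → f′ ≈ g′ [mod x ]
    [mod]-resp f≈f′ g≈g′ (h , f≈g+xh) = h , ≈-trans (≈-sym f≈f′) (≈-trans f≈g+xh (+-congʳ g≈g′))

    [mod]-+ : ∀ {f f′ g g′} → f ≈ f′ [mod x ] → g ≈ g′ [mod x ] → f +S g ≈ f′ +S g′ [mod x ]
    [mod]-+ {f} {f′} {g} {g′} (h , f≈) (h′ , g≈) = h +S h′ , (begin
      f +S g
        ≈⟨ +-cong f≈ g≈ ⟩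
      (f′ +S x *S h) +S (g′ +S x *S h′)
        ≈⟨ solve 5 (λ f g x h h′ → (f :+ x :* h) :+ (g :+ x :* h′) := (f :+ g) :+ x :* (h :+ h′)) ≈-refl f′ g′ x h h′ ⟩
      (f′ +S g′) +S x *S (h +S h′)
        ∎)

    [mod]-neg : ∀ {f f′} → f ≈ f′ [mod x ] → -S f ≈ -S f′ [mod x ]
    [mod]-neg {f} {f′} (h , f≈) = -S h , (begin
      -S f                   ≈⟨ -‿cong f≈ ⟩
      -S (f′ +S x *S h)      ≈⟨ solve 3 (λ f x h → :- (f :+ x :* h) := :- f :+ x :* (:- h)) ≈-refl f′ x h ⟩
      -S f′ +S x *S (-S h)   ∎)

    [mod]-* : ∀ {f f′ g g′} → f ≈ f′ [mod x ] → g ≈ g′ [mod x ] → f *S g ≈ f′ *S g′ [mod x ]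
    [mod]-* {f} {f′} {g} {g′} (h , f≈) (h′ , g≈) = f′ *S h′ +S h *S g′ +S (x *S h) *S h′ , (begin
      f *S g
        ≈⟨ *-cong f≈ g≈ ⟩
      (f′ +S x *S h) *S (g′ +S x *S h′)
        ≈⟨ solve 5 (λ f g x h h′ → (f :+ x :* h) :* (g :+ x :* h′)
                                  := f :* g :+ x :* (f :* h′ :+ h :* g :+ x :* h :* h′)) ≈-refl f′ g′ x h h′ ⟩
      f′ *S g′ +S x *S (f′ *S h′ +S h *S g′ +S (x *S h) *S h′)
        ∎)

    [mod]-*ˡ : ∀ a {g g′} → g ≈ g′ [mod x ] → a *S g ≈ a *S g′ [mod x ]
    [mod]-*ˡ a = [mod]-* [mod]-refl

    [mod]-^ : ∀ {f g} n → f ≈ g [mod x ] → f ^ n ≈ g ^ n [mod x ]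
    [mod]-^ zero    f≡g = [mod]-refl
    [mod]-^ (suc n) f≡g = [mod]-* f≡g ([mod]-^ n f≡g)

  [mod]-weaken : ∀ {f g} x y → f ≈ g [mod x *S y ] → f ≈ g [mod x ]
  [mod]-weaken x y (h , f≈) = y *S h , ≈-trans f≈ (+-congˡ (*-assoc x y h))

  [mod]-scale : ∀ {f g} a x → f ≈ g [mod x ] → a *S f ≈ a *S g [mod a *S x ]
  [mod]-scale {f} {g} a x (h , f≈) = h , (begin
    a *S f                    ≈⟨ *-congˡ f≈ ⟩
    a *S (g +S x *S h)        ≈⟨ solve 4 (λ a g x h → a :* (g :+ x :* h) := a :* g :+ (a :* x) :* h) ≈-refl a g x h ⟩
    a *S g +S (a *S x) *S h   ∎)

  modSetoid : Series → Setoid 0ℓ 0ℓ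
  modSetoid x = record
    { _≈_ = _≈_[mod x ]
    ; isEquivalence = record { refl = [mod]-refl ; sym = [mod]-sym ; trans = [mod]-trans }
    }

  [mod]-^-weaken : ∀ {f g} x {s t} → s ≤ t → f ≈ g [mod x ^ t ] → f ≈ g [mod x ^ s ]
  [mod]-^-weaken x {s} s≤t (h , f≈) with ℕP.m≤n⇒∃[o]m+o≡n s≤t
  ... | d , refl = [mod]-weaken (x ^ s) (x ^ d) (h , ≈-trans f≈ (+-congˡ (*-congʳ (^-homo-* x s d))))

  [mod]-^-scale : ∀ {f g} x a t → f ≈ g [mod x ^ t ] → x ^ a *S f ≈ x ^ a *S g [mod x ^ (a ℕ.+ t) ]
  [mod]-^-scale x a t f≡g with [mod]-scale (x ^ a) (x ^ t) f≡g
  ... | h , f≈ = h , ≈-trans f≈ (+-congˡ (*-congʳ (≈-sym (^-homo-* x a t))))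

  x^≈0[mod] : ∀ x {s a} → s ≤ a → x ^ a ≈ 0S [mod x ^ s ]
  x^≈0[mod] x {s} {a} s≤a with ℕP.m≤n⇒∃[o]m+o≡n s≤a
  ... | d , refl = x ^ d , ≈-trans (^-homo-* x s d) (≈-sym (+-identityˡ _))

  x^*≈x^[mod] : ∀ x e {b n f} → n ≤ e ℕ.+ b → f ≈ 1S [mod x ^ b ] → x ^ e *S f ≈ x ^ e [mod x ^ n ]
  x^*≈x^[mod] x e {b} n≤e+b f≡1 = [mod]-^-weaken x n≤e+b ([mod]-resp ≈-refl (*-identityʳ _) ([mod]-^-scale x e b f≡1))

  [mod]-resp-modulus : ∀ {f g x y} → x ≈ y → f ≈ g [mod x ] → f ≈ g [mod y ]
  [mod]-resp-modulus x≈y (h , f≈) = h , ≈-trans f≈ (+-congˡ (*-congʳ x≈y))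

∑S : ℕ → (ℕ → Series) → Series
∑S zero    F = F 0
∑S (suc k) F = ∑S k F +S F (suc k)

∑S-coeff : ∀ k F i → ∑S k F i ≡ sumTo k (λ j → F j i)
∑S-coeff zero    F i = refl
∑S-coeff (suc k) F i = ≡.trans (+S-coeff (∑S k F) (F (suc k)) i) (cong (_+ F (suc k) i) (∑S-coeff k F i))

∑S-cong : ∀ k {F G} → (∀ j → F j ≈ G j) → ∑S k F ≈ ∑S k G
∑S-cong zero    F≈G = F≈G 0
∑S-cong (suc k) F≈G = +-cong (∑S-cong k F≈G) (F≈G (suc k))

∑S-distrib-+ : ∀ k F G → ∑S k (λ j → F j +S G j) ≈ ∑S k F +S ∑S k G
∑S-distrib-+ zero    F G = ≈-refl
∑S-distrib-+ (suc k) F G = ≈-trans (+-congʳ (∑S-distrib-+ k F G))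
  (solve 4 (λ a b c d → (a :+ b) :+ (c :+ d) := (a :+ c) :+ (b :+ d)) ≈-refl (∑S k F) (∑S k G) (F (suc k)) (G (suc k)))

*-distribˡ-∑S : ∀ k c F → c *S ∑S k F ≈ ∑S k (λ j → c *S F j)
*-distribˡ-∑S zero    c F = ≈-refl
*-distribˡ-∑S (suc k) c F = ≈-trans (distribˡ c (∑S k F) (F (suc k))) (+-congʳ (*-distribˡ-∑S k c F))

∑S-suc : ∀ k F → ∑S (suc k) F ≈ F 0 +S ∑S k (λ j → F (suc j))
∑S-suc zero    F = ≈-refl
∑S-suc (suc k) F = ≈-trans (+-congʳ (∑S-suc k F)) (solve 3 (λ a b c → (a :+ b) :+ c := a :+ (b :+ c)) ≈-refl (F 0) _ _)

∑S-extend : ∀ {a b F} → a ≤ b → (∀ j → a < j → F j ≈ 0S) → ∑S b F ≈ ∑S a F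
∑S-extend {a} {b} {F} a≤b F≈0 = mk≈ λ i → ≡.trans (∑S-coeff b F i) (≡.trans
  (sumTo-extend a b a≤b (λ j a<j → ≡.trans (coeff (F≈0 j a<j) i) (0S-coeff i))) (≡.sym (∑S-coeff a F i)))

∑S-[mod] : ∀ k {F G x} → (∀ j → j ≤ k → F j ≈ G j [mod x ]) → ∑S k F ≈ ∑S k G [mod x ]
∑S-[mod] zero    F≡G = F≡G 0 z≤n
∑S-[mod] (suc k) F≡G = [mod]-+ (∑S-[mod] k (λ j j≤k → F≡G j (ℕP.m≤n⇒m≤1+n j≤k))) (F≡G (suc k) ℕP.≤-refl)

shift : (ℕ → Series) → ℕ → Series
shift F zero    = 0S
shift F (suc k) = F k

∑S-shift : ∀ k (w F : ℕ → Series) → ∑S (suc k) (λ j → w j *S shift F j) ≈ ∑S k (λ j → w (suc j) *S F j)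
∑S-shift k w F = ≈-trans (∑S-suc k _) (≈-trans (+-congʳ (zeroʳ (w 0))) (+-identityˡ _))

module _ where
  open ≡.≡-Reasoning

  q : Series
  q zero          = 0ℤ
  q (suc zero)    = 1ℤ
  q (suc (suc _)) = 0ℤ

  q*S-coeff-zero : ∀ f → (q *S f) zero ≡ 0ℤ
  q*S-coeff-zero f = ≡.trans (*S-coeff q f zero) (ℤP.*-zeroˡ (f 0))

  q*S-coeff-suc : ∀ f k → (q *S f) (suc k) ≡ f k
  q*S-coeff-suc f k = begin
    (q *S f) (suc k)                                        ≡⟨ *S-coeff q f (suc k) ⟩
    sumTo (suc k) (λ i → q i * f (suc k ∸ i))               ≡⟨ sumTo-suc k _ ⟩
    0ℤ * f (suc k) + sumTo k (λ i → q (suc i) * f (k ∸ i))  ≡⟨ ℤP.+-identityˡ _ ⟩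
    sumTo k (λ i → q (suc i) * f (k ∸ i))                   ≡⟨ lowest k ⟩
    f k                                                     ∎
    where
    lowest : ∀ k → sumTo k (λ i → q (suc i) * f (k ∸ i)) ≡ f k
    lowest zero    = ℤP.*-identityˡ (f 0)
    lowest (suc k) = begin
      sumTo (suc k) (λ i → q (suc i) * f (suc k ∸ i))
        ≡⟨ sumTo-suc k _ ⟩
      1ℤ * f (suc k) + sumTo k (λ i → 0ℤ * f (k ∸ i))
        ≡⟨ cong₂ _+_ (ℤP.*-identityˡ (f (suc k))) (sumTo-zero k (λ _ _ → refl)) ⟩
      f (suc k) + 0ℤ
        ≡⟨ ℤP.+-identityʳ (f (suc k)) ⟩
      f (suc k)
        ∎

  q^*S-coeff-< : ∀ a f k → k < a → (q ^ a *S f) k ≡ 0ℤ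
  q^*S-coeff-< (suc a) f zero    _         = ≡.trans (coeff (*-assoc q (q ^ a) f) 0) (q*S-coeff-zero _)
  q^*S-coeff-< (suc a) f (suc k) (s≤s k<a) =
    ≡.trans (coeff (*-assoc q (q ^ a) f) (suc k)) (≡.trans (q*S-coeff-suc _ k) (q^*S-coeff-< a f k k<a))

  q^*S-coeff-+ : ∀ a f k → (q ^ a *S f) (a ℕ.+ k) ≡ f k
  q^*S-coeff-+ zero    f k = coeff (*-identityˡ f) k
  q^*S-coeff-+ (suc a) f k =
    ≡.trans (coeff (*-assoc q (q ^ a) f) (suc a ℕ.+ k)) (≡.trans (q*S-coeff-suc _ (a ℕ.+ k)) (q^*S-coeff-+ a f k))

  [mod]q^⇒coeff : ∀ {f g} t → f ≈ g [mod q ^ t ] → ∀ k → k < t → f k ≡ g k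
  [mod]q^⇒coeff {f} {g} t (h , f≈g+qᵗh) k k<t = begin
    f k                   ≡⟨ coeff f≈g+qᵗh k ⟩
    (g +S q ^ t *S h) k   ≡⟨ +S-coeff g _ k ⟩
    g k + (q ^ t *S h) k  ≡⟨ cong (_+_ (g k)) (q^*S-coeff-< t h k k<t) ⟩
    g k + 0ℤ              ≡⟨ ℤP.+-identityʳ (g k) ⟩
    g k                   ∎

  coeff⇒[mod]q^ : ∀ {f g} t → (∀ k → k < t → f k ≡ g k) → f ≈ g [mod q ^ t ]
  coeff⇒[mod]q^ {f} {g} t f≡g = h , mk≈ λ k → ≡.trans (agree k) (≡.sym (+S-coeff g _ k))
    where
    h : Series
    h k = f (t ℕ.+ k) - g (t ℕ.+ k)
    i≡j+[i-j] : ∀ i j → i ≡ j + (i - j)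
    i≡j+[i-j] = solve-∀
    agree : ∀ k → f k ≡ g k + (q ^ t *S h) k
    agree k with k ℕ.<? t
    ... | yes k<t = begin
      f k                   ≡⟨ f≡g k k<t ⟩
      g k                   ≡⟨ ℤP.+-identityʳ (g k) ⟨
      g k + 0ℤ              ≡⟨ cong (_+_ (g k)) (q^*S-coeff-< t h k k<t) ⟨
      g k + (q ^ t *S h) k  ∎
    ... | no k≮t with ℕP.m≤n⇒∃[o]m+o≡n (ℕP.≮⇒≥ k≮t)
    ...   | j , refl = begin
      f (t ℕ.+ j)                            ≡⟨ i≡j+[i-j] (f (t ℕ.+ j)) (g (t ℕ.+ j)) ⟩
      g (t ℕ.+ j) + h j                      ≡⟨ cong (_+_ (g (t ℕ.+ j))) (q^*S-coeff-+ t h j) ⟨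
      g (t ℕ.+ j) + (q ^ t *S h) (t ℕ.+ j)   ∎

  q^-coeff : ∀ a i → (q ^ a) i ≡ δ i a
  q^-coeff a i = ≡.trans (coeff (≈-sym (*-identityʳ (q ^ a))) i) (q^*1S-coeff i)
    where
    q^*1S-coeff : ∀ i → (q ^ a *S 1S) i ≡ δ i a
    q^*1S-coeff i with i ℕ.<? a
    ... | yes i<a = ≡.trans (q^*S-coeff-< a 1S i i<a) (≡.sym (δ-≢ i a (ℕP.<⇒≢ i<a)))
    ... | no i≮a with ℕP.m≤n⇒∃[o]m+o≡n (ℕP.≮⇒≥ i≮a)
    ...   | zero  , refl = ≡.trans (q^*S-coeff-+ a 1S 0) (≡.sym (δ-≡ (a ℕ.+ 0) a (ℕP.+-identityʳ a)))
    ...   | suc j , refl = ≡.trans (q^*S-coeff-+ a 1S (suc j)) (≡.sym (δ-≢ (a ℕ.+ suc j) a (ℕP.m+1+n≢m a)))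

  constS*S-coeff : ∀ c f i → (constS c *S f) i ≡ c * f i
  constS*S-coeff c f zero    = *S-coeff (constS c) f 0
  constS*S-coeff c f (suc i) = begin
    (constS c *S f) (suc i)                                  ≡⟨ *S-coeff (constS c) f (suc i) ⟩
    sumTo (suc i) (λ j → constS c j * f (suc i ∸ j))         ≡⟨ sumTo-suc i _ ⟩
    c * f (suc i) + sumTo i (λ j → 0ℤ * f (i ∸ j))           ≡⟨ cong (_+_ (c * f (suc i))) (sumTo-zero i (λ _ _ → refl)) ⟩
    c * f (suc i) + 0ℤ                                       ≡⟨ ℤP.+-identityʳ _ ⟩
    c * f (suc i)                                            ∎

  1S^n≈1S : ∀ n → 1S ^ n ≈ 1S
  1S^n≈1S zero    = mk≈ λ _ → refl
  1S^n≈1S (suc n) = ≈-trans (*-identityˡ _) (1S^n≈1S n)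

-- Gaussian binomials and a finite form of Jacobi's identity

module Gaussian (x : Series) where

  open ≈-Reasoning

  1-x^_ : ℕ → Series
  1-x^ a = 1S +S -S (x ^ a)

  pochhammer : ℕ → Series
  pochhammer zero    = 1S
  pochhammer (suc n) = pochhammer n *S 1-x^ suc n

  qBinomial : ℕ → ℕ → Series
  qBinomial m       zero    = 1S
  qBinomial zero    (suc k) = 0S
  qBinomial (suc m) (suc k) = qBinomial m k +S x ^ suc k *S qBinomial m (suc k)

  qBinomial-vanish : ∀ {m k} → m < k → qBinomial m k ≈ 0S
  qBinomial-vanish {zero}  {suc k} _         = ≈-refl
  qBinomial-vanish {suc m} {suc k} (s≤s m<k) = begin
    qBinomial m k +S x ^ suc k *S qBinomial m (suc k)
      ≈⟨ +-cong (qBinomial-vanish m<k) (*-congˡ (qBinomial-vanish (ℕP.m≤n⇒m≤1+n m<k))) ⟩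
    0S +S x ^ suc k *S 0S
      ≈⟨ +-identityˡ _ ⟩
    x ^ suc k *S 0S
      ≈⟨ zeroʳ _ ⟩
    0S
      ∎

  qBinomial-diag : ∀ m → qBinomial m m ≈ 1S
  qBinomial-diag zero    = ≈-refl
  qBinomial-diag (suc m) = begin
    qBinomial m m +S x ^ suc m *S qBinomial m (suc m) ≈⟨ +-cong (qBinomial-diag m) (*-congˡ (qBinomial-vanish (ℕP.n<1+n m))) ⟩
    1S +S x ^ suc m *S 0S                              ≈⟨ solve 1 (λ y → con 1ℤ :+ y :* con 0ℤ := con 1ℤ) ≈-refl (x ^ suc m) ⟩
    1S                                                 ∎

  x^*qBinomial-cong : ∀ {a b} m k → (k ≤ m → a ≡ b) → x ^ a *S qBinomial m k ≈ x ^ b *S qBinomial m k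
  x^*qBinomial-cong m k a≡b with k ℕ.≤? m
  ... | yes k≤m rewrite a≡b k≤m = ≈-refl
  ... | no  k≰m = ≈-trans (*-congˡ vanish) (≈-trans (zeroʳ _) (≈-sym (≈-trans (*-congˡ vanish) (zeroʳ _))))
    where
    vanish : qBinomial m k ≈ 0S
    vanish = qBinomial-vanish (ℕP.≰⇒> k≰m)

  x^*x^ : ∀ a b {c} f → a ℕ.+ b ≡ c → x ^ a *S (x ^ b *S f) ≈ x ^ c *S f
  x^*x^ a b f refl = ≈-trans (≈-sym (*-assoc _ _ _)) (*-congʳ (≈-sym (^-homo-* x a b)))

  x^*x^*qBinomial : ∀ a b c m k → (k ≤ m → a ℕ.+ b ≡ c) → x ^ a *S (x ^ b *S qBinomial m k) ≈ x ^ c *S qBinomial m k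
  x^*x^*qBinomial a b c m k a+b≡c = ≈-trans (x^*x^ a b (qBinomial m k) refl) (x^*qBinomial-cong m k a+b≡c)

  qBinomial-pascal : ∀ m k → qBinomial (suc m) (suc k) ≈ x ^ (m ∸ k) *S qBinomial m k +S qBinomial m (suc k)
  qBinomial-pascal zero zero = solve 1 (λ y → con 1ℤ :+ y :* con 0ℤ := con 1ℤ :* con 1ℤ :+ con 0ℤ) ≈-refl (x ^ 1)
  qBinomial-pascal zero (suc k) = solve 1 (λ y → con 0ℤ :+ y :* con 0ℤ := con 1ℤ :* con 0ℤ :+ con 0ℤ) ≈-refl (x ^ suc (suc k))
  qBinomial-pascal (suc m) zero = begin
    1S +S x ^ 1 *S qBinomial (suc m) 1
      ≈⟨ +-congˡ (*-congˡ (qBinomial-pascal m zero)) ⟩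
    1S +S x ^ 1 *S (x ^ m *S 1S +S qBinomial m 1)
      ≈⟨ solve 3 (λ x₁ xₘ b → con 1ℤ :+ x₁ :* (xₘ :* con 1ℤ :+ b) := x₁ :* xₘ :* con 1ℤ :+ (con 1ℤ :+ x₁ :* b)) ≈-refl
           (x ^ 1) (x ^ m) (qBinomial m 1) ⟩
    x ^ 1 *S x ^ m *S 1S +S qBinomial (suc m) 1
      ≈⟨ +-congʳ (*-congʳ (^-homo-* x 1 m)) ⟨
    x ^ suc m *S 1S +S qBinomial (suc m) 1
      ∎
  qBinomial-pascal (suc m) (suc k) = begin
    qBinomial (suc m) (suc k) +S x ^ suc (suc k) *S qBinomial (suc m) (suc (suc k))
      ≈⟨ +-cong (qBinomial-pascal m k) (*-congˡ (qBinomial-pascal m (suc k))) ⟩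
    (x ^ (m ∸ k) *S A +S B) +S x ^ suc (suc k) *S (x ^ (m ∸ suc k) *S B +S C)
      ≈⟨ solve 6 (λ xa xb xc a b c → (xa :* a :+ b) :+ xb :* (xc :* b :+ c) := xa :* a :+ (b :+ xb :* c) :+ xb :* (xc :* b)) ≈-refl
           (x ^ (m ∸ k)) (x ^ suc (suc k)) (x ^ (m ∸ suc k)) A B C ⟩
    x ^ (m ∸ k) *S A +S (B +S x ^ suc (suc k) *S C) +S x ^ suc (suc k) *S (x ^ (m ∸ suc k) *S B)
      ≈⟨ +-congˡ (≈-trans (x^*x^*qBinomial (suc (suc k)) (m ∸ suc k) (suc m) m (suc k)
                             (λ k<m → cong suc (ℕP.m+[n∸m]≡n k<m)))
                  (≈-sym (x^*x^*qBinomial (m ∸ k) (suc k) (suc m) m (suc k)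
                    (λ k<m → ≡.trans (ℕP.+-comm (m ∸ k) (suc k)) (cong suc (ℕP.m+[n∸m]≡n (ℕP.<⇒≤ k<m))))))) ⟩
    x ^ (m ∸ k) *S A +S (B +S x ^ suc (suc k) *S C) +S x ^ (m ∸ k) *S (x ^ suc k *S B)
      ≈⟨ solve 5 (λ xa xk a b r → xa :* a :+ r :+ xa :* (xk :* b) := xa :* (a :+ xk :* b) :+ r) ≈-refl
           (x ^ (m ∸ k)) (x ^ suc k) A B (B +S x ^ suc (suc k) *S C) ⟩
    x ^ (m ∸ k) *S qBinomial (suc m) (suc k) +S qBinomial (suc m) (suc (suc k))
      ∎
    where
    A B C : Series
    A = qBinomial m k
    B = qBinomial m (suc k)
    C = qBinomial m (suc (suc k))

  1-x^≈1[mod] : ∀ {s a} → s ≤ a → 1-x^ a ≈ 1S [mod x ^ s ]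
  1-x^≈1[mod] s≤a = [mod]-resp ≈-refl (solve 0 (con 1ℤ :+ :- con 0ℤ := con 1ℤ) ≈-refl)
    ([mod]-+ [mod]-refl ([mod]-neg (x^≈0[mod] x s≤a)))

  pochhammer-[mod] : ∀ {k n} → k ≤ n → pochhammer n ≈ pochhammer k [mod x ^ suc k ]
  pochhammer-[mod] {k} {zero}  z≤n   = [mod]-refl
  pochhammer-[mod] {k} {suc n} k≤1+n with k ℕ.≟ suc n
  ... | yes refl  = [mod]-refl
  ... | no k≢1+n  = [mod]-trans lastFactor (pochhammer-[mod] (ℕP.≤-pred k<1+n))
    where
    k<1+n : k < suc n
    k<1+n = ℕP.≤∧≢⇒< k≤1+n k≢1+n
    lastFactor : pochhammer n *S 1-x^ suc n ≈ pochhammer n [mod x ^ suc k ]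
    lastFactor = [mod]-resp ≈-refl (*-identityʳ _) ([mod]-*ˡ (pochhammer n) (1-x^≈1[mod] k<1+n))

  qBinomial*pochhammer-lower : ∀ {m k} → k ≤ m → qBinomial m k *S pochhammer k ≈ 1S [mod x ^ suc (m ∸ k) ]
  qBinomial*pochhammer-lower {m}     {zero}  _         = ≈⇒≈[mod] (*-identityˡ 1S)
  qBinomial*pochhammer-lower {suc m} {suc k} (s≤s k≤m) with k ℕ.≟ m
  ... | yes refl rewrite ℕP.n∸n≡0 k =
    [mod]-resp (*-congʳ (≈-sym (qBinomial-diag (suc k)))) (*-identityˡ _) ([mod]-*ˡ 1S (pochhammer-[mod] {n = suc k} z≤n))
  ... | no k≢m = [mod]-resp (≈-sym expand) simplify ([mod]-+ ([mod]-* (qBinomial*pochhammer-lower k≤m) [mod]-refl) upperTerm)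
    where
    k<m : k < m
    k<m = ℕP.≤∧≢⇒< k≤m k≢m
    bound : suc (m ∸ k) ≤ suc k ℕ.+ suc (m ∸ suc k)
    bound = ≡.subst (λ j → suc (m ∸ k) ≤ suc k ℕ.+ j) (ℕP.+-∸-assoc 1 k<m) (s≤s (ℕP.m≤n+m (m ∸ k) k))
    A B : Series
    A = qBinomial m k
    B = qBinomial m (suc k)
    expand : qBinomial (suc m) (suc k) *S pochhammer (suc k)
           ≈ A *S pochhammer k *S 1-x^ suc k +S x ^ suc k *S (B *S pochhammer (suc k))
    expand = solve 5 (λ a b p xₖ o → (a :+ xₖ :* b) :* (p :* o) := a :* p :* o :+ xₖ :* (b :* (p :* o))) ≈-refl
               A B (pochhammer k) (x ^ suc k) (1-x^ suc k)
    simplify : 1S *S 1-x^ suc k +S x ^ suc k *S 1S ≈ 1S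
    simplify = solve 1 (λ xₖ → con 1ℤ :* (con 1ℤ :+ :- xₖ) :+ xₖ :* con 1ℤ := con 1ℤ) ≈-refl (x ^ suc k)
    upperTerm : x ^ suc k *S (B *S pochhammer (suc k)) ≈ x ^ suc k *S 1S [mod x ^ suc (m ∸ k) ]
    upperTerm = [mod]-^-weaken x bound ([mod]-^-scale x (suc k) (suc (m ∸ suc k)) (qBinomial*pochhammer-lower k<m))

  qBinomial*pochhammer-upper : ∀ {m k} → k ≤ m → qBinomial m k *S pochhammer (m ∸ k) ≈ 1S [mod x ^ suc k ]
  qBinomial*pochhammer-upper {m}     {zero}  _         = [mod]-resp (≈-sym (*-identityˡ _)) ≈-refl (pochhammer-[mod] {n = m} z≤n)
  qBinomial*pochhammer-upper {suc m} {suc k} (s≤s k≤m) with k ℕ.≟ m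
  ... | yes refl rewrite ℕP.n∸n≡0 k = ≈⇒≈[mod] (≈-trans (*-congʳ (qBinomial-diag (suc k))) (*-identityˡ 1S))
  ... | no k≢m = [mod]-resp (≈-sym expand) simplify ([mod]-+ lowerTerm ([mod]-* (qBinomial*pochhammer-upper k<m) [mod]-refl))
    where
    k<m : k < m
    k<m = ℕP.≤∧≢⇒< k≤m k≢m
    a j : ℕ
    a = m ∸ k
    j = m ∸ suc k
    a≡1+j : a ≡ suc j
    a≡1+j = ℕP.+-∸-assoc 1 k<m
    A B : Series
    A = qBinomial m k
    B = qBinomial m (suc k)
    lastFactor : pochhammer a ≈ pochhammer j *S 1-x^ a
    lastFactor rewrite a≡1+j = ≈-refl
    expand : qBinomial (suc m) (suc k) *S pochhammer a ≈ x ^ a *S (A *S pochhammer a) +S B *S pochhammer j *S 1-x^ a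
    expand = begin
      qBinomial (suc m) (suc k) *S pochhammer a
        ≈⟨ *-congʳ (qBinomial-pascal m k) ⟩
      (x ^ a *S A +S B) *S pochhammer a
        ≈⟨ solve 4 (λ xₐ a b p → (xₐ :* a :+ b) :* p := xₐ :* (a :* p) :+ b :* p) ≈-refl (x ^ a) A B (pochhammer a) ⟩
      x ^ a *S (A *S pochhammer a) +S B *S pochhammer a
        ≈⟨ +-congˡ (≈-trans (*-congˡ lastFactor) (≈-sym (*-assoc _ _ _))) ⟩
      x ^ a *S (A *S pochhammer a) +S B *S pochhammer j *S 1-x^ a
        ∎
    simplify : x ^ a *S 1S +S 1S *S 1-x^ a ≈ 1S
    simplify = solve 1 (λ xₐ → xₐ :* con 1ℤ :+ con 1ℤ :* (con 1ℤ :+ :- xₐ) := con 1ℤ) ≈-refl (x ^ a)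
    bound : suc (suc k) ≤ a ℕ.+ suc k
    bound = ≡.subst (λ i → suc (suc k) ≤ i ℕ.+ suc k) (≡.sym a≡1+j) (s≤s (ℕP.m≤n+m (suc k) j))
    lowerTerm : x ^ a *S (A *S pochhammer a) ≈ x ^ a *S 1S [mod x ^ suc (suc k) ]
    lowerTerm = [mod]-^-weaken x bound ([mod]-^-scale x a (suc k) (qBinomial*pochhammer-upper k≤m))

  qBinomial-pascal₂ : ∀ m k → qBinomial (suc (suc m)) (suc k)
    ≈ x ^ suc k *S qBinomial m (suc k) +S (1S +S x ^ suc m) *S qBinomial m k +S shift (λ j → x ^ (m ∸ j) *S qBinomial m j) k
  qBinomial-pascal₂ m zero = begin
    1S +S x ^ 1 *S qBinomial (suc m) 1
      ≈⟨ +-congˡ (*-congˡ (qBinomial-pascal m zero)) ⟩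
    1S +S x ^ 1 *S (x ^ m *S 1S +S qBinomial m 1)
      ≈⟨ solve 3 (λ y xₘ b → con 1ℤ :+ (y :* con 1ℤ) :* (xₘ :* con 1ℤ :+ b)
                           := (y :* con 1ℤ) :* b :+ (con 1ℤ :+ y :* xₘ) :* con 1ℤ :+ con 0ℤ) ≈-refl x (x ^ m) (qBinomial m 1) ⟩
    x ^ 1 *S qBinomial m 1 +S (1S +S x ^ suc m) *S 1S +S 0S
      ∎
  qBinomial-pascal₂ m (suc k) = begin
    qBinomial (suc m) (suc k) +S x ^ suc (suc k) *S qBinomial (suc m) (suc (suc k))
      ≈⟨ +-cong (qBinomial-pascal m k) (*-congˡ (qBinomial-pascal m (suc k))) ⟩
    x ^ (m ∸ k) *S A +S B +S x ^ suc (suc k) *S (x ^ (m ∸ suc k) *S B +S C)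
      ≈⟨ solve 6 (λ xa xb xc a b c → xa :* a :+ b :+ xb :* (xc :* b :+ c) := xb :* c :+ b :+ xa :* a :+ xb :* (xc :* b)) ≈-refl
           (x ^ (m ∸ k)) (x ^ suc (suc k)) (x ^ (m ∸ suc k)) A B C ⟩
    x ^ suc (suc k) *S C +S B +S x ^ (m ∸ k) *S A +S x ^ suc (suc k) *S (x ^ (m ∸ suc k) *S B)
      ≈⟨ +-congˡ (x^*x^*qBinomial (suc (suc k)) (m ∸ suc k) (suc m) m (suc k) (λ k<m → cong suc (ℕP.m+[n∸m]≡n k<m))) ⟩
    x ^ suc (suc k) *S C +S B +S x ^ (m ∸ k) *S A +S x ^ suc m *S B
      ≈⟨ solve 6 (λ xc xa xm a b c → xc :* c :+ b :+ xa :* a :+ xm :* b := xc :* c :+ (con 1ℤ :+ xm) :* b :+ xa :* a) ≈-refl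
           (x ^ suc (suc k)) (x ^ (m ∸ k)) (x ^ suc m) A B C ⟩
    x ^ suc (suc k) *S C +S (1S +S x ^ suc m) *S B +S x ^ (m ∸ k) *S A
      ∎
    where
    A B C : Series
    A = qBinomial m k
    B = qBinomial m (suc k)
    C = qBinomial m (suc (suc k))

module FiniteJacobi (x : Series) where

  open Gaussian x
  open ≈-Reasoning

  sgnS : ℕ → Series
  sgnS k = constS (sgn k)

  sgnS-suc : ∀ k → sgnS (suc k) ≈ -S sgnS k
  sgnS-suc zero          = constS-neg 1ℤ
  sgnS-suc (suc zero)    = constS-neg (- 1ℤ)
  sgnS-suc (suc (suc k)) = sgnS-suc k

  sgnS-square : ∀ k → sgnS k *S sgnS k ≈ 1S
  sgnS-square k = ≈-trans (≈-sym (constS-* (sgn k) (sgn k))) (mk≈ λ i → cong (λ c → constS c i) (sgn-square k))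

  term : ℕ → ℕ → Series
  term n k = sgnS k *S (x ^ exponent n k *S qBinomial (double n) k)

  1+x^[2n+1] : ℕ → Series
  1+x^[2n+1] n = 1S +S x ^ suc (double n)

  term-vanish : ∀ {n k} → double n < k → term n k ≈ 0S
  term-vanish {n} {k} 2n<k = begin
    sgnS k *S (x ^ exponent n k *S qBinomial (double n) k)
      ≈⟨ *-congˡ (*-congˡ (qBinomial-vanish 2n<k)) ⟩
    sgnS k *S (x ^ exponent n k *S 0S)
      ≈⟨ solve 2 (λ s e → s :* (e :* con 0ℤ) := con 0ℤ) ≈-refl (sgnS k) (x ^ exponent n k) ⟩
    0S
      ∎

  x^n*term-suc : ∀ n k → x ^ n *S term n (suc k) ≈ (-S sgnS k) *S (x ^ exponent n k *S (x ^ suc k *S qBinomial (double n) (suc k)))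
  x^n*term-suc n k = begin
    x ^ n *S (sgnS (suc k) *S (x ^ exponent n (suc k) *S B))
      ≈⟨ *-congˡ (*-congʳ (sgnS-suc k)) ⟩
    x ^ n *S ((-S sgnS k) *S (x ^ exponent n (suc k) *S B))
      ≈⟨ solve 4 (λ xₙ s e b → xₙ :* (s :* (e :* b)) := s :* (xₙ :* (e :* b))) ≈-refl
           (x ^ n) (-S sgnS k) (x ^ exponent n (suc k)) B ⟩
    (-S sgnS k) *S (x ^ n *S (x ^ exponent n (suc k) *S B))
      ≈⟨ *-congˡ (x^*x^ n (exponent n (suc k)) B refl) ⟩
    (-S sgnS k) *S (x ^ (n ℕ.+ exponent n (suc k)) *S B)
      ≈⟨ *-congˡ (x^*x^ (exponent n k) (suc k) B (≡.trans (≡.sym (exponent-suc n k)) (ℕP.+-comm _ n))) ⟨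
    (-S sgnS k) *S (x ^ exponent n k *S (x ^ suc k *S B))
      ∎
    where
    B : Series
    B = qBinomial (double n) (suc k)

  x^[1+n]*term : ∀ n k → x ^ suc n *S term n k
    ≈ (-S sgnS (suc k)) *S (x ^ exponent n (suc k) *S (x ^ (double n ∸ k) *S qBinomial (double n) k))
  x^[1+n]*term n k = begin
    x ^ suc n *S (sgnS k *S (x ^ exponent n k *S B))
      ≈⟨ solve 4 (λ y s e b → y :* (s :* (e :* b)) := (:- (:- s)) :* (y :* (e :* b))) ≈-refl
           (x ^ suc n) (sgnS k) (x ^ exponent n k) B ⟩
    (-S (-S sgnS k)) *S (x ^ suc n *S (x ^ exponent n k *S B))
      ≈⟨ *-cong (-‿cong (≈-sym (sgnS-suc k))) (x^*x^ (suc n) (exponent n k) B (ℕP.+-comm (suc n) _)) ⟩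
    (-S sgnS (suc k)) *S (x ^ (exponent n k ℕ.+ suc n) *S B)
      ≈⟨ *-congˡ (x^*x^*qBinomial (exponent n (suc k)) (double n ∸ k) (exponent n k ℕ.+ suc n) (double n) k
                                  (λ k≤2n → ≡.sym (exponent-reflect n k k≤2n))) ⟨
    (-S sgnS (suc k)) *S (x ^ exponent n (suc k) *S (x ^ (double n ∸ k) *S B))
      ∎
    where
    B : Series
    B = qBinomial (double n) k

  term-suc : ∀ n k → term (suc n) k
    ≈ x ^ n *S term n k +S (-S 1+x^[2n+1] n) *S shift (term n) k +S x ^ suc n *S shift (shift (term n)) k
  term-suc n zero = begin
    1S *S (x ^ triangular n *S 1S)
      ≈⟨ *-congˡ (*-congʳ (≈-trans (^-congʳ x (≡.trans (≡.sym (exponent-zero n)) (ℕP.+-comm _ n))) (^-homo-* x n _))) ⟩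
    1S *S (x ^ n *S x ^ exponent n 0 *S 1S)
      ≈⟨ solve 4 (λ xₙ e c y → con 1ℤ :* (xₙ :* e :* con 1ℤ)
                             := xₙ :* (con 1ℤ :* (e :* con 1ℤ)) :+ (:- c) :* con 0ℤ :+ y :* con 0ℤ) ≈-refl
           (x ^ n) (x ^ exponent n 0) (1+x^[2n+1] n) (x ^ suc n) ⟩
    x ^ n *S term n 0 +S (-S 1+x^[2n+1] n) *S 0S +S x ^ suc n *S 0S
      ∎
  term-suc n (suc k) = begin
    sgnS (suc k) *S (e *S qBinomial (suc (suc (double n))) (suc k))
      ≈⟨ *-cong (sgnS-suc k) (*-congˡ (qBinomial-pascal₂ (double n) k)) ⟩
    (-S s) *S (e *S (x ^ suc k *S B₁ +S 1+x^[2n+1] n *S B₀ +S shift Q k))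
      ≈⟨ solve 7 (λ s e xₖ b₁ c b₀ r → (:- s) :* (e :* (xₖ :* b₁ :+ c :* b₀ :+ r))
                   := (:- s) :* (e :* (xₖ :* b₁)) :+ (:- c) :* (s :* (e :* b₀)) :+ (:- s) :* (e :* r)) ≈-refl
           s e (x ^ suc k) B₁ (1+x^[2n+1] n) B₀ (shift Q k) ⟩
    (-S s) *S (e *S (x ^ suc k *S B₁)) +S (-S 1+x^[2n+1] n) *S term n k +S (-S s) *S (e *S shift Q k)
      ≈⟨ +-cong (+-congʳ (≈-sym (x^n*term-suc n k))) (lowest k) ⟩
    x ^ n *S term n (suc k) +S (-S 1+x^[2n+1] n) *S term n k +S x ^ suc n *S shift (term n) k
      ∎
    where
    s e B₀ B₁ : Series
    s = sgnS k
    e = x ^ exponent n k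
    B₀ = qBinomial (double n) k
    B₁ = qBinomial (double n) (suc k)
    Q : ℕ → Series
    Q j = x ^ (double n ∸ j) *S qBinomial (double n) j
    lowest : ∀ k → (-S sgnS k) *S (x ^ exponent n k *S shift Q k) ≈ x ^ suc n *S shift (term n) k
    lowest zero    = solve 3 (λ s e y → (:- s) :* (e :* con 0ℤ) := y :* con 0ℤ) ≈-refl (sgnS 0) (x ^ exponent n 0) (x ^ suc n)
    lowest (suc j) = ≈-sym (x^[1+n]*term n j)

  moment : (ℕ → Series) → ℕ → Series
  moment w n = ∑S (double n) (λ k → w k *S term n k)

  moment-extend : ∀ w n {b} → double n ≤ b → ∑S b (λ k → w k *S term n k) ≈ moment w n
  moment-extend w n 2n≤b = ∑S-extend 2n≤b (λ k 2n<k → ≈-trans (*-congˡ (term-vanish 2n<k)) (zeroʳ (w k)))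

  moment-suc : ∀ w n → moment w (suc n)
    ≈ x ^ n *S moment w n +S (-S 1+x^[2n+1] n) *S moment (λ k → w (suc k)) n +S x ^ suc n *S moment (λ k → w (suc (suc k))) n
  moment-suc w n = begin
    ∑S (2 ℕ.+ m) (λ k → w k *S term (suc n) k)
      ≈⟨ ∑S-cong (2 ℕ.+ m) (λ k → ≈-trans (*-congˡ (term-suc n k)) (expand (w k))) ⟩
    ∑S (2 ℕ.+ m) (λ k → x ^ n *S (w k *S term n k) +S (-S 1+x^[2n+1] n) *S (w k *S shift (term n) k)
                        +S x ^ suc n *S (w k *S shift (shift (term n)) k))
      ≈⟨ ≈-trans (∑S-distrib-+ (2 ℕ.+ m) _ _) (+-congʳ (∑S-distrib-+ (2 ℕ.+ m) _ _)) ⟩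
    ∑S (2 ℕ.+ m) (λ k → x ^ n *S (w k *S term n k)) +S ∑S (2 ℕ.+ m) (λ k → (-S 1+x^[2n+1] n) *S (w k *S shift (term n) k))
      +S ∑S (2 ℕ.+ m) (λ k → x ^ suc n *S (w k *S shift (shift (term n)) k))
      ≈⟨ +-cong (+-cong (*-distribˡ-∑S (2 ℕ.+ m) _ _) (*-distribˡ-∑S (2 ℕ.+ m) _ _)) (*-distribˡ-∑S (2 ℕ.+ m) _ _) ⟨
    x ^ n *S ∑S (2 ℕ.+ m) (λ k → w k *S term n k) +S (-S 1+x^[2n+1] n) *S ∑S (2 ℕ.+ m) (λ k → w k *S shift (term n) k)
      +S x ^ suc n *S ∑S (2 ℕ.+ m) (λ k → w k *S shift (shift (term n)) k)
      ≈⟨ +-cong (+-cong (*-congˡ (moment-extend w n (ℕP.m≤n+m m 2)))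
                        (*-congˡ (≈-trans (∑S-shift (suc m) w (term n)) (moment-extend (λ k → w (suc k)) n (ℕP.n≤1+n m)))))
                (*-congˡ (≈-trans (∑S-shift (suc m) w (shift (term n))) (∑S-shift m (λ k → w (suc k)) (term n)))) ⟩
    x ^ n *S moment w n +S (-S 1+x^[2n+1] n) *S moment (λ k → w (suc k)) n +S x ^ suc n *S moment (λ k → w (suc (suc k))) n
      ∎
    where
    m : ℕ
    m = double n
    expand : ∀ v {a b c t₀ t₁ t₂} →
             v *S (a *S t₀ +S b *S t₁ +S c *S t₂) ≈ a *S (v *S t₀) +S b *S (v *S t₁) +S c *S (v *S t₂)
    expand v {a} {b} {c} {t₀} {t₁} {t₂} =
      solve 7 (λ v a b c t₀ t₁ t₂ → v :* (a :* t₀ :+ b :* t₁ :+ c :* t₂)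
                                  := a :* (v :* t₀) :+ b :* (v :* t₁) :+ c :* (v :* t₂)) ≈-refl
        v a b c t₀ t₁ t₂

  moment-+ : ∀ w w′ n → moment (λ k → w k +S w′ k) n ≈ moment w n +S moment w′ n
  moment-+ w w′ n = ≈-trans (∑S-cong (double n) (λ k → distribʳ (term n k) (w k) (w′ k))) (∑S-distrib-+ (double n) _ _)

  moment₀ moment₁ : ℕ → Series
  moment₀ = moment (λ _ → 1S)
  moment₁ = moment (λ k → constS (+ k))

  moment₀-zero : moment₀ 0 ≈ 1S
  moment₀-zero = solve 0 (con 1ℤ :* (con 1ℤ :* (con 1ℤ :* con 1ℤ)) := con 1ℤ) ≈-refl

  moment₀-vanish : ∀ n → moment₀ (suc n) ≈ 0S
  moment₀-vanish zero = begin
    moment₀ 1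
      ≈⟨ moment-suc (λ _ → 1S) 0 ⟩
    1S *S M +S (-S (1S +S x ^ 1)) *S M +S x ^ 1 *S M
      ≈⟨ solve 2 (λ y m → con 1ℤ :* m :+ (:- (con 1ℤ :+ y)) :* m :+ y :* m := con 0ℤ) ≈-refl (x ^ 1) M ⟩
    0S
      ∎
    where
    M : Series
    M = moment₀ 0
  moment₀-vanish (suc n) = begin
    moment₀ (2 ℕ.+ n)
      ≈⟨ moment-suc (λ _ → 1S) (suc n) ⟩
    x ^ suc n *S M +S (-S 1+x^[2n+1] (suc n)) *S M +S x ^ suc (suc n) *S M
      ≈⟨ +-cong (+-cong (*-congˡ M≈0) (*-congˡ M≈0)) (*-congˡ M≈0) ⟩
    x ^ suc n *S 0S +S (-S 1+x^[2n+1] (suc n)) *S 0S +S x ^ suc (suc n) *S 0S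
      ≈⟨ solve 3 (λ a b c → a :* con 0ℤ :+ b :* con 0ℤ :+ c :* con 0ℤ := con 0ℤ) ≈-refl
           (x ^ suc n) (-S 1+x^[2n+1] (suc n)) (x ^ suc (suc n)) ⟩
    0S
      ∎
    where
    M : Series
    M = moment₀ (suc n)
    M≈0 : M ≈ 0S
    M≈0 = moment₀-vanish n

  moment-weight-suc : ∀ j n →
    moment (λ k → constS (+ (suc j ℕ.+ k))) n ≈ moment₀ n +S moment (λ k → constS (+ (j ℕ.+ k))) n
  moment-weight-suc j n = ≈-trans (∑S-cong (double n) (λ k → *-congʳ (constS-+ 1ℤ (+ (j ℕ.+ k))))) (moment-+ _ _ n)

  moment₁-suc : ∀ n → moment₁ (suc n)
    ≈ x ^ n *S moment₁ n +S (-S 1+x^[2n+1] n) *S (moment₀ n +S moment₁ n)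
      +S x ^ suc n *S (moment₀ n +S (moment₀ n +S moment₁ n))
  moment₁-suc n = ≈-trans (moment-suc (λ k → constS (+ k)) n)
    (+-cong (+-congˡ (*-congˡ (moment-weight-suc 0 n)))
            (*-congˡ (≈-trans (moment-weight-suc 1 n) (+-congˡ (moment-weight-suc 0 n)))))

  moment₁-closed : ∀ n → moment₁ (suc n) ≈ sgnS (suc n) *S (pochhammer (suc n) *S pochhammer n)
  moment₁-closed zero = begin
    moment₁ 1
      ≈⟨ moment₁-suc 0 ⟩
    1S *S M₁ +S (-S (1S +S x ^ 1)) *S (M₀ +S M₁) +S x ^ 1 *S (M₀ +S (M₀ +S M₁))
      ≈⟨ +-cong (+-cong (*-congˡ M₁≈0) (*-congˡ (+-cong moment₀-zero M₁≈0)))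
                (*-congˡ (+-cong moment₀-zero (+-cong moment₀-zero M₁≈0))) ⟩
    1S *S 0S +S (-S (1S +S x ^ 1)) *S (1S +S 0S) +S x ^ 1 *S (1S +S (1S +S 0S))
      ≈⟨ solve 1 (λ y → let y¹ = y :* con 1ℤ in
                   con 1ℤ :* con 0ℤ :+ (:- (con 1ℤ :+ y¹)) :* (con 1ℤ :+ con 0ℤ) :+ y¹ :* (con 1ℤ :+ (con 1ℤ :+ con 0ℤ))
                   := con (- 1ℤ) :* ((con 1ℤ :* (con 1ℤ :+ :- y¹)) :* con 1ℤ)) ≈-refl x ⟩
    sgnS 1 *S (pochhammer 1 *S pochhammer 0)
      ∎
    where
    M₀ M₁ : Series
    M₀ = moment₀ 0
    M₁ = moment₁ 0
    M₁≈0 : M₁ ≈ 0S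
    M₁≈0 = zeroˡ _
  moment₁-closed (suc n) = begin
    moment₁ (2 ℕ.+ n)
      ≈⟨ moment₁-suc (suc n) ⟩
    a *S M₁ +S (-S 1+x^[2n+1] (suc n)) *S (M₀ +S M₁) +S b *S (M₀ +S (M₀ +S M₁))
      ≈⟨ +-cong (+-cong (*-congˡ IH) (*-cong (-‿cong (+-congˡ (≈-sym ab≈x^2n+3))) (+-cong M₀≈0 IH)))
                (*-congˡ (+-cong M₀≈0 (+-cong M₀≈0 IH))) ⟩
    a *S M +S (-S (1S +S a *S b)) *S (0S +S M) +S b *S (0S +S (0S +S M))
      ≈⟨ solve 4 (λ a b t p → let M = (:- t) :* ((p :* (con 1ℤ :+ :- a)) :* p) in
                   a :* M :+ (:- (con 1ℤ :+ a :* b)) :* (con 0ℤ :+ M) :+ b :* (con 0ℤ :+ (con 0ℤ :+ M))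
                   := t :* (((p :* (con 1ℤ :+ :- a)) :* (con 1ℤ :+ :- b)) :* (p :* (con 1ℤ :+ :- a)))) ≈-refl
           a b (sgnS n) (pochhammer n) ⟩
    sgnS (2 ℕ.+ n) *S (pochhammer (2 ℕ.+ n) *S pochhammer (suc n))
      ∎
    where
    a b M₀ M₁ M : Series
    a = x ^ suc n
    b = x ^ suc (suc n)
    M₀ = moment₀ (suc n)
    M₁ = moment₁ (suc n)
    M = (-S sgnS n) *S (pochhammer (suc n) *S pochhammer n)
    IH : M₁ ≈ M
    IH = ≈-trans (moment₁-closed n) (*-congʳ (sgnS-suc n))
    M₀≈0 : M₀ ≈ 0S
    M₀≈0 = moment₀-vanish n
    ab≈x^2n+3 : a *S b ≈ x ^ suc (double (suc n))
    ab≈x^2n+3 = ≈-trans (≈-sym (^-homo-* x (suc n) (suc (suc n)))) (^-congʳ x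
      (cong suc (≡.trans (ℕP.+-suc n (suc n)) (cong suc (≡.trans (ℕP.+-suc n n) (cong suc (≡.sym (double≡n+n n))))))))

module PochhammerCube (x : Series) where

  open Gaussian x
  open FiniteJacobi x
  open MultiSetoidReasoning

  x^exponent*qBinomial*pochhammer≈x^exponent : ∀ n k → k ≤ double n →
    x ^ exponent n k *S (qBinomial (double n) k *S pochhammer n) ≈ x ^ exponent n k [mod x ^ n ]
  x^exponent*qBinomial*pochhammer≈x^exponent n k k≤2n with k ℕ.≤? n
  ... | yes k≤n = x^*≈x^[mod] x (exponent n k) (n≤exponent+1+k n k)
    ([mod]-trans ([mod]-*ˡ B (pochhammer-[mod] k≤n))
                 ([mod]-^-weaken x (s≤s k≤2n∸k) (qBinomial*pochhammer-lower k≤2n)))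
    where
    B : Series
    B = qBinomial (double n) k
    k≤2n∸k : k ≤ double n ∸ k
    k≤2n∸k = ℕP.≤-trans k≤n (ℕP.≤-trans (ℕP.≤-reflexive (≡.sym (double∸n≡n n)))
                                         (ℕP.∸-monoʳ-≤ (double n) k≤n))
  ... | no k≰n = x^*≈x^[mod] x (exponent n k) (n≤exponent+1+[double∸k] n k k≤2n)
    ([mod]-trans ([mod]-*ˡ B (pochhammer-[mod] 2n∸k≤n))
                 ([mod]-^-weaken x (s≤s (ℕP.≤-trans 2n∸k≤n n≤k)) (qBinomial*pochhammer-upper k≤2n)))
    where
    B : Series
    B = qBinomial (double n) k
    n≤k : n ≤ k
    n≤k = ℕP.<⇒≤ (ℕP.≰⇒> k≰n)
    2n∸k≤n : double n ∸ k ≤ n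
    2n∸k≤n = ℕP.≤-trans (ℕP.∸-monoʳ-≤ (double n) n≤k) (ℕP.≤-reflexive (double∸n≡n n))

  jacobiPolynomial : ℕ → Series
  jacobiPolynomial n = ∑S (double n) (λ k → constS (+ k) *S (sgnS k *S x ^ exponent n k))

  pochhammer*moment₁ : ∀ n → pochhammer n *S moment₁ n ≈ jacobiPolynomial n [mod x ^ n ]
  pochhammer*moment₁ n = [mod]-resp (≈-sym distribute) ≈-refl
    (∑S-[mod] (double n) λ k k≤2n →
      [mod]-*ˡ (constS (+ k)) ([mod]-*ˡ (sgnS k) (x^exponent*qBinomial*pochhammer≈x^exponent n k k≤2n)))
    where
    distribute : pochhammer n *S moment₁ n
               ≈ ∑S (double n) (λ k → constS (+ k) *S (sgnS k *S (x ^ exponent n k *S (qBinomial (double n) k *S pochhammer n))))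
    distribute = ≈-trans (*-distribˡ-∑S (double n) _ _) (∑S-cong (double n) λ k →
      solve 5 (λ p w s e b → p :* (w :* (s :* (e :* b))) := w :* (s :* (e :* (b :* p)))) ≈-refl
        (pochhammer n) (constS (+ k)) (sgnS k) (x ^ exponent n k) (qBinomial (double n) k))

  pochhammer³-[mod] : ∀ N → pochhammer N ^ 3 ≈ sgnS (suc N) *S jacobiPolynomial (suc N) [mod x ^ suc N ]
  pochhammer³-[mod] N = begin⟨ modSetoid (x ^ suc N) ⟩
    P ^ 3                                ≈⟨ ≈⇒≈[mod] regroup ⟩
    s *S (P *S (s *S (P *S P)))          ≈⟨ [mod]-*ˡ s ([mod]-* P′≡P ([mod]-*ˡ s ([mod]-* P′≡P [mod]-refl))) ⟨
    s *S (P′ *S (s *S (P′ *S P)))        ≈⟨ ≈⇒≈[mod] (*-congˡ (*-congˡ (moment₁-closed N))) ⟨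
    s *S (P′ *S moment₁ (suc N))         ≈⟨ [mod]-*ˡ s (pochhammer*moment₁ (suc N)) ⟩
    s *S jacobiPolynomial (suc N)        ∎
    where
    s P P′ : Series
    s = sgnS (suc N)
    P = pochhammer N
    P′ = pochhammer (suc N)
    P′≡P : P′ ≈ P [mod x ^ suc N ]
    P′≡P = pochhammer-[mod] (ℕP.n≤1+n N)
    regroup : P ^ 3 ≈ s *S (P *S (s *S (P *S P)))
    regroup = ≈-trans (≈-sym (*-identityˡ (P ^ 3))) (≈-trans (*-congʳ (≈-sym (sgnS-square (suc N))))
      (solve 2 (λ s p → (s :* s) :* p :^ 3 := s :* (p :* (s :* (p :* p)))) ≈-refl s P))

-- Jacobi's identity for the series q^d

jacobiCoeff : ℕ → ℤ
jacobiCoeff m = sgn m * + (2 ℕ.* m ℕ.+ 1)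

jacobiTerm : ℕ → ℕ → ℕ → ℤ
jacobiTerm d i m = δ i (d ℕ.* triangular m) * jacobiCoeff m

-- Σ_{m ≥ 0} (-1)^m (2m + 1) q^(d T(m)); for d ≥ 1 the coefficient of q^i only involves m ≤ i.
jacobiSeries : ℕ → Series
jacobiSeries d i = sumTo i (jacobiTerm d i)

module _ (d : ℕ) where

  open Gaussian (q ^ d) using (pochhammer)
  open FiniteJacobi (q ^ d) using (sgnS)
  open PochhammerCube (q ^ d)
  open ≡.≡-Reasoning

  jacobiPolynomial-coeff : ∀ n i → jacobiPolynomial n i ≡ sumTo (double n) (λ k → + k * (sgn k * δ i (d ℕ.* exponent n k)))
  jacobiPolynomial-coeff n i = ≡.trans (∑S-coeff (double n) _ i) (sumTo-cong-≗ (double n) λ k → begin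
    (constS (+ k) *S (sgnS k *S (q ^ d) ^ exponent n k)) i
      ≡⟨ constS*S-coeff (+ k) _ i ⟩
    + k * (sgnS k *S (q ^ d) ^ exponent n k) i
      ≡⟨ cong (+ k *_) (constS*S-coeff (sgn k) _ i) ⟩
    + k * (sgn k * ((q ^ d) ^ exponent n k) i)
      ≡⟨ cong (λ c → + k * (sgn k * c)) (≡.trans (coeff (^-assocʳ q d (exponent n k)) i) (q^-coeff _ i)) ⟩
    + k * (sgn k * δ i (d ℕ.* exponent n k))
      ∎)

  private
    F : ℕ → ℕ → ℕ → ℤ
    F n i k = + k * (sgn k * δ i (d ℕ.* exponent n k))

  -- The indices N - j and N + 1 + j carry the same exponent T(j); their weights differ by 2j + 1.
  coefficient-pair : ∀ N i j → j ≤ N → F (suc N) i (N ∸ j) + F (suc N) i (suc N ℕ.+ j) ≡ sgn (suc N) * jacobiTerm d i j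
  coefficient-pair N i j j≤N = begin
    F (suc N) i (N ∸ j) + F (suc N) i (suc N ℕ.+ j)
      ≡⟨ cong₂ _+_ (cong₂ (λ s e → + (N ∸ j) * (s * δ i (d ℕ.* e))) (sgn-∸ j≤N) below)
                   (≡.trans (cong (λ e → + (suc N ℕ.+ j) * (sgn (suc N ℕ.+ j) * δ i (d ℕ.* e))) (exponent-above N j))
                     (cong₂ (λ w s → w * (s * D)) weight (≡.trans (sgn-+ (suc N) j) (cong (_* sgn j) (sgn-suc N))))) ⟩
    + (N ∸ j) * (sgn N * sgn j * D) + (+ (N ∸ j) + + (2 ℕ.* j ℕ.+ 1)) * (- sgn N * sgn j * D)
      ≡⟨ cancel (+ (N ∸ j)) (+ (2 ℕ.* j ℕ.+ 1)) (sgn N) (sgn j) D ⟩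
    - sgn N * (D * (sgn j * + (2 ℕ.* j ℕ.+ 1)))
      ≡⟨ cong (_* (D * jacobiCoeff j)) (sgn-suc N) ⟨
    sgn (suc N) * jacobiTerm d i j
      ∎
    where
    D : ℤ
    D = δ i (d ℕ.* triangular j)
    below : exponent (suc N) (N ∸ j) ≡ triangular j
    below = ≡.trans (cong (λ n → exponent (suc n) (N ∸ j)) (≡.sym (ℕP.m∸n+n≡m j≤N))) (exponent-below (N ∸ j) j)
    weight : + (suc N ℕ.+ j) ≡ + (N ∸ j) + + (2 ℕ.* j ℕ.+ 1)
    weight = ≡.trans (cong +_ (≡.trans (cong (λ n → suc n ℕ.+ j) (≡.sym (ℕP.m∸n+n≡m j≤N))) (reorder (N ∸ j) j)))
                     (ℤP.pos-+ (N ∸ j) (2 ℕ.* j ℕ.+ 1))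
      where
      reorder : ∀ a j → suc (a ℕ.+ j) ℕ.+ j ≡ a ℕ.+ (2 ℕ.* j ℕ.+ 1)
      reorder = ℕSolver.solve-∀
    cancel : ∀ a b g s D → a * (g * s * D) + (a + b) * (- g * s * D) ≡ - g * (D * (s * b))
    cancel = solve-∀

  <d*⇒<d*triangular : ∀ {i m} → i < d ℕ.* m → i < d ℕ.* triangular m
  <d*⇒<d*triangular {m = m} i<dm = ℕP.<-≤-trans i<dm (ℕP.*-monoʳ-≤ d (n≤triangular m))

  jacobiTerm-vanish : ∀ {i m} → i < d ℕ.* m → jacobiTerm d i m ≡ 0ℤ
  jacobiTerm-vanish {i} {m} i<dm =
    ≡.trans (cong (_* jacobiCoeff m) (δ-≢ i _ (ℕP.<⇒≢ (<d*⇒<d*triangular i<dm)))) (ℤP.*-zeroˡ (jacobiCoeff m))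

  jacobiSeries-truncate : ∀ N i → i < d ℕ.* suc N → sumTo N (jacobiTerm d i) ≡ jacobiSeries d i
  jacobiSeries-truncate N i i<d[1+N] =
    ≡.trans (≡.sym (sumTo-extend N (N ℕ.+ i) (ℕP.m≤m+n N i) (λ m N<m → jacobiTerm-vanish (beyond-N N<m))))
            (sumTo-extend i (N ℕ.+ i) (ℕP.m≤n+m i N) (λ m i<m → jacobiTerm-vanish (beyond-i i<m)))
    where
    beyond-N : ∀ {m} → N < m → i < d ℕ.* m
    beyond-N N<m = ℕP.<-≤-trans i<d[1+N] (ℕP.*-monoʳ-≤ d N<m)
    beyond-i : ∀ {m} → i < m → i < d ℕ.* m
    beyond-i {m} i<m = ℕP.<-≤-trans i<m (ℕP.m≤n*m m d {{d≢0}})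
      where
      d≢0 : ℕ.NonZero d
      d≢0 = ℕP.m*n≢0⇒m≢0 d {{ℕ.≢-nonZero (ℕP.m<n⇒n≢0 i<d[1+N])}}

  jacobiPolynomial-coeff-< : ∀ N i → i < d ℕ.* suc N → jacobiPolynomial (suc N) i ≡ sgn (suc N) * jacobiSeries d i
  jacobiPolynomial-coeff-< N i i<d[1+N] = begin
    jacobiPolynomial (suc N) i
      ≡⟨ jacobiPolynomial-coeff (suc N) i ⟩
    sumTo (double (suc N)) F′
      ≡⟨ cong (λ n → sumTo n F′) (double≡n+n (suc N)) ⟩
    sumTo (suc N ℕ.+ suc N) F′
      ≡⟨ sumTo-split N (suc N) F′ ⟩
    sumTo N F′ + (sumTo N G + G (suc N))
      ≡⟨ cong₂ (λ u v → u + (sumTo N G + v)) (sumTo-reverse N F′) G-last ⟩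
    sumTo N (λ j → F′ (N ∸ j)) + (sumTo N G + 0ℤ)
      ≡⟨ cong (_+_ (sumTo N (λ j → F′ (N ∸ j)))) (ℤP.+-identityʳ _) ⟩
    sumTo N (λ j → F′ (N ∸ j)) + sumTo N G
      ≡⟨ sumTo-distrib-+ N _ _ ⟨
    sumTo N (λ j → F′ (N ∸ j) + G j)
      ≡⟨ sumTo-cong N (coefficient-pair N i) ⟩
    sumTo N (λ j → sgn (suc N) * jacobiTerm d i j)
      ≡⟨ *-distribˡ-sumTo N (sgn (suc N)) (jacobiTerm d i) ⟨
    sgn (suc N) * sumTo N (jacobiTerm d i)
      ≡⟨ cong (sgn (suc N) *_) (jacobiSeries-truncate N i i<d[1+N]) ⟩
    sgn (suc N) * jacobiSeries d i
      ∎
    where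
    F′ G : ℕ → ℤ
    F′ = F (suc N) i
    G j = F′ (suc N ℕ.+ j)
    G-last : G (suc N) ≡ 0ℤ
    G-last rewrite exponent-above (suc N) (suc N) | δ-≢ i _ (ℕP.<⇒≢ (<d*⇒<d*triangular i<d[1+N])) =
      ≡.trans (cong (+ (suc N ℕ.+ suc N) *_) (ℤP.*-zeroʳ (sgn (suc N ℕ.+ suc N)))) (ℤP.*-zeroʳ (+ (suc N ℕ.+ suc N)))

  pochhammer³-[mod]-q^ : ∀ N → pochhammer N ^ 3 ≈ jacobiSeries d [mod q ^ (d ℕ.* suc N) ]
  pochhammer³-[mod]-q^ N =
    [mod]-trans ([mod]-resp-modulus (^-assocʳ q d (suc N)) (pochhammer³-[mod] N)) (coeff⇒[mod]q^ (d ℕ.* suc N) λ i i<d[1+N] → begin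
      (sgnS (suc N) *S jacobiPolynomial (suc N)) i        ≡⟨ constS*S-coeff (sgn (suc N)) _ i ⟩
      sgn (suc N) * jacobiPolynomial (suc N) i            ≡⟨ cong (sgn (suc N) *_) (jacobiPolynomial-coeff-< N i i<d[1+N]) ⟩
      sgn (suc N) * (sgn (suc N) * jacobiSeries d i)      ≡⟨ ℤP.*-assoc (sgn (suc N)) _ _ ⟨
      sgn (suc N) * sgn (suc N) * jacobiSeries d i        ≡⟨ cong (_* jacobiSeries d i) (sgn-square (suc N)) ⟩
      1ℤ * jacobiSeries d i                               ≡⟨ ℤP.*-identityˡ _ ⟩
      jacobiSeries d i                                    ∎)

-- Reduction modulo 7

module Frobenius (x : Series) where

  open Gaussian x
  module Gaussian⁷ = Gaussian (x ^ 7)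
  open ≈-Reasoning

  1-x^-frobenius : ∀ a → (1-x^ a) ^ 7 ≈ Gaussian⁷.1-x^ a [mod constS (+ 7) ]
  1-x^-frobenius a = h , (begin
    (1S +S -S y) ^ 7
      ≈⟨ solve 1 (λ y → (con 1ℤ :+ :- y) :^ 7
                        := con 1ℤ :+ :- (y :^ 7) :+ con (+ 7) :* (:- y :+ con (+ 3) :* y :^ 2 :+ con (- (+ 5)) :* y :^ 3
                                                               :+ con (+ 5) :* y :^ 4 :+ con (- (+ 3)) :* y :^ 5 :+ y :^ 6))
                 ≈-refl y ⟩
    1S +S -S (y ^ 7) +S constS (+ 7) *S h
      ≈⟨ +-congʳ (+-congˡ (-‿cong y⁷≈)) ⟩
    1S +S -S ((x ^ 7) ^ a) +S constS (+ 7) *S h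
      ∎)
    where
    y h : Series
    y = x ^ a
    h = -S y +S constS (+ 3) *S y ^ 2 +S constS (- (+ 5)) *S y ^ 3 +S constS (+ 5) *S y ^ 4 +S constS (- (+ 3)) *S y ^ 5 +S y ^ 6
    y⁷≈ : y ^ 7 ≈ (x ^ 7) ^ a
    y⁷≈ = ≈-trans (^-assocʳ x a 7) (≈-trans (^-congʳ x (ℕP.*-comm a 7)) (≈-sym (^-assocʳ x 7 a)))

  pochhammer-frobenius : ∀ n → pochhammer n ^ 7 ≈ Gaussian⁷.pochhammer n [mod constS (+ 7) ]
  pochhammer-frobenius zero    = ≈⇒≈[mod] (1S^n≈1S 7)
  pochhammer-frobenius (suc n) =
    [mod]-resp (≈-sym (^-distrib-* (pochhammer n) (1-x^ suc n) 7)) ≈-refl ([mod]-* (pochhammer-frobenius n) (1-x^-frobenius (suc n)))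

open Gaussian q using (1-x^_; pochhammer)
module Gaussian⁷ = Gaussian (q ^ 7)
open Frobenius q using (pochhammer-frobenius)

·S≈*S : ∀ f g → f ·S g ≈ f *S g
·S≈*S f g = mk≈ λ k → ≡.sym (*S-coeff f g k)

oneS≈1S : oneS ≈ 1S
oneS≈1S = mk≈ λ { zero → refl ; (suc k) → refl }

powS≈^ : ∀ f n → powS f n ≈ f ^ n
powS≈^ f zero    = oneS≈1S
powS≈^ f (suc n) = ≈-trans (·S≈*S f (powS f n)) (*-cong ≈-refl (powS≈^ f n))

oneMinusQ≈1-q^ : ∀ m → oneMinusQ m ≈ 1-x^ m
oneMinusQ≈1-q^ m = mk≈ λ k → ≡.sym (begin
  (1S +S -S (q ^ m)) k     ≡⟨ +S-coeff 1S _ k ⟩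
  1S k + (-S (q ^ m)) k    ≡⟨ cong₂ _+_ (≡.sym (coeff oneS≈1S k)) (≡.trans (-S-coeff _ k) (cong -_ (q^-coeff m k))) ⟩
  oneS k + - δ k m         ≡⟨ cong (_+_ (oneS k)) (negδ k) ⟩
  oneMinusQ m k            ∎)
  where
  open ≡.≡-Reasoning
  negδ : ∀ k → - δ k m ≡ (if does (k ≟ m) then - 1ℤ else 0ℤ)
  negδ k with does (k ≟ m)
  ... | true  = refl
  ... | false = refl

etaProd≈pochhammer^24 : ∀ N → etaProd N ≈ pochhammer N ^ 24
etaProd≈pochhammer^24 zero    = ≈-trans oneS≈1S (≈-sym (1S^n≈1S 24))
etaProd≈pochhammer^24 (suc N) = begin
  powS (oneMinusQ (suc N)) 24 ·S etaProd N
    ≈⟨ ·S≈*S (powS (oneMinusQ (suc N)) 24) (etaProd N) ⟩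
  powS (oneMinusQ (suc N)) 24 *S etaProd N
    ≈⟨ *-cong (≈-trans (powS≈^ (oneMinusQ (suc N)) 24) (^-congˡ 24 (oneMinusQ≈1-q^ (suc N)))) (etaProd≈pochhammer^24 N) ⟩
  (1-x^ suc N) ^ 24 *S pochhammer N ^ 24
    ≈⟨ *-comm ((1-x^ suc N) ^ 24) (pochhammer N ^ 24) ⟩
  pochhammer N ^ 24 *S (1-x^ suc N) ^ 24
    ≈⟨ ^-distrib-* (pochhammer N) (1-x^ suc N) 24 ⟨
  pochhammer (suc N) ^ 24
    ∎
  where open ≈-Reasoning

jacobiSeries-extend : ∀ d N i → i ≤ N → jacobiSeries (suc d) i ≡ sumTo N (jacobiTerm (suc d) i)
jacobiSeries-extend d N i i≤N =
  ≡.sym (sumTo-extend i N i≤N λ m i<m → jacobiTerm-vanish (suc d) (ℕP.<-≤-trans i<m (ℕP.m≤m+n m (d ℕ.* m))))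

jacobiTerm-convolution : ∀ N m r →
  sumTo N (λ i → jacobiTerm 7 i r * jacobiTerm 1 (N ∸ i) m)
  ≡ (if does (N ≟ tri m ℕ.+ 7 ℕ.* tri r) then sgn (m ℕ.+ r) * + (2 ℕ.* m ℕ.+ 1) * + (2 ℕ.* r ℕ.+ 1) else 0ℤ)
jacobiTerm-convolution N m r = begin
  sumTo N (λ i → jacobiTerm 7 i r * jacobiTerm 1 (N ∸ i) m)
    ≡⟨ sumTo-cong-≗ N (λ i → ℤP.*-assoc (δ i a) (jacobiCoeff r) _) ⟩
  sumTo N (λ i → δ i a * (jacobiCoeff r * jacobiTerm 1 (N ∸ i) m))
    ≡⟨ picked ⟩
  δ N (triangular m ℕ.+ a) * c
    ≡⟨ cong (λ t → δ N t * c) (cong₂ (λ u v → u ℕ.+ 7 ℕ.* v) (tri≡triangular m) (tri≡triangular r)) ⟨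
  δ N (tri m ℕ.+ 7 ℕ.* tri r) * c
    ≡⟨ if≟≡δ* N _ c ⟨
  (if does (N ≟ tri m ℕ.+ 7 ℕ.* tri r) then c else 0ℤ)
    ∎
  where
  open ≡.≡-Reasoning
  a : ℕ
  a = 7 ℕ.* triangular r
  c : ℤ
  c = sgn (m ℕ.+ r) * + (2 ℕ.* m ℕ.+ 1) * + (2 ℕ.* r ℕ.+ 1)
  picked : sumTo N (λ i → δ i a * (jacobiCoeff r * jacobiTerm 1 (N ∸ i) m)) ≡ δ N (triangular m ℕ.+ a) * c
  picked with a ℕ.≤? N
  ... | yes a≤N = begin
    sumTo N (λ i → δ i a * (jacobiCoeff r * jacobiTerm 1 (N ∸ i) m))
      ≡⟨ sumTo-δ-≤ N a _ a≤N ⟩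
    jacobiCoeff r * (δ (N ∸ a) (1 ℕ.* triangular m) * jacobiCoeff m)
      ≡⟨ cong (λ D → jacobiCoeff r * (D * jacobiCoeff m)) (≡.trans (cong (δ (N ∸ a)) (ℕP.*-identityˡ _)) (δ-∸ (triangular m) a≤N)) ⟩
    jacobiCoeff r * (δ N (triangular m ℕ.+ a) * jacobiCoeff m)
      ≡⟨ regroup (sgn m) (sgn r) (+ (2 ℕ.* m ℕ.+ 1)) (+ (2 ℕ.* r ℕ.+ 1)) (δ N (triangular m ℕ.+ a)) ⟩
    δ N (triangular m ℕ.+ a) * (sgn m * sgn r * + (2 ℕ.* m ℕ.+ 1) * + (2 ℕ.* r ℕ.+ 1))
      ≡⟨ cong (λ s → δ N (triangular m ℕ.+ a) * (s * + (2 ℕ.* m ℕ.+ 1) * + (2 ℕ.* r ℕ.+ 1))) (sgn-+ m r) ⟨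
    δ N (triangular m ℕ.+ a) * c
      ∎
    where
    regroup : ∀ sₘ sᵣ wₘ wᵣ D → sᵣ * wᵣ * (D * (sₘ * wₘ)) ≡ D * (sₘ * sᵣ * wₘ * wᵣ)
    regroup = solve-∀
  ... | no a≰N = ≡.trans (sumTo-δ-< N a _ N<a) (≡.sym (≡.trans (cong (_* c) (δ-≢ N _ N≢Tm+a)) (ℤP.*-zeroˡ c)))
    where
    N<a : N < a
    N<a = ℕP.≰⇒> a≰N
    N≢Tm+a : N ≢ triangular m ℕ.+ a
    N≢Tm+a = ℕP.<⇒≢ (ℕP.<-≤-trans N<a (ℕP.m≤n+m a (triangular m)))

jacobiSeries-convolution : ∀ N → (jacobiSeries 7 *S jacobiSeries 1) N ≡ rhsSum N
jacobiSeries-convolution N = begin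
  (jacobiSeries 7 *S jacobiSeries 1) N
    ≡⟨ *S-coeff (jacobiSeries 7) (jacobiSeries 1) N ⟩
  sumTo N (λ i → jacobiSeries 7 i * jacobiSeries 1 (N ∸ i))
    ≡⟨ sumTo-cong N (λ i i≤N → cong₂ _*_ (jacobiSeries-extend 6 N i i≤N)
                                          (jacobiSeries-extend 0 N (N ∸ i) (ℕP.m∸n≤m N i))) ⟩
  sumTo N (λ i → sumTo N (jacobiTerm 7 i) * sumTo N (jacobiTerm 1 (N ∸ i)))
    ≡⟨ sumTo-cong-≗ N (λ i → sumTo-*-sumTo N (jacobiTerm 7 i) (jacobiTerm 1 (N ∸ i))) ⟩
  sumTo N (λ i → sumTo N (λ m → sumTo N (λ r → jacobiTerm 7 i r * jacobiTerm 1 (N ∸ i) m)))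
    ≡⟨ sumTo-comm N N _ ⟩
  sumTo N (λ m → sumTo N (λ i → sumTo N (λ r → jacobiTerm 7 i r * jacobiTerm 1 (N ∸ i) m)))
    ≡⟨ sumTo-cong-≗ N (λ m → sumTo-comm N N _) ⟩
  sumTo N (λ m → sumTo N (λ r → sumTo N (λ i → jacobiTerm 7 i r * jacobiTerm 1 (N ∸ i) m)))
    ≡⟨ sumTo-cong-≗ N (λ m → sumTo-cong-≗ N (jacobiTerm-convolution N m)) ⟩
  rhsSum N
    ∎
  where open ≡.≡-Reasoning

pochhammer-cong : ∀ {x y} n → x ≈ y → Gaussian.pochhammer x n ≈ Gaussian.pochhammer y n
pochhammer-cong zero    x≈y = ≈-refl
pochhammer-cong (suc n) x≈y = *-cong (pochhammer-cong n x≈y) (+-congˡ (-‿cong (^-congˡ (suc n) x≈y)))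

etaProd≈cubes[mod7] : ∀ n → etaProd n ≈ Gaussian⁷.pochhammer n ^ 3 *S pochhammer n ^ 3 [mod constS (+ 7) ]
etaProd≈cubes[mod7] n = [mod]-resp (≈-sym P²⁴≈[P⁷]³P³) ≈-refl ([mod]-* ([mod]-^ 3 (pochhammer-frobenius n)) [mod]-refl)
  where
  P : Series
  P = pochhammer n
  P²⁴≈[P⁷]³P³ : etaProd n ≈ (P ^ 7) ^ 3 *S P ^ 3
  P²⁴≈[P⁷]³P³ = ≈-trans (etaProd≈pochhammer^24 n) (≈-trans (^-homo-* P 21 3) (*-congʳ (≈-sym (^-assocʳ P 7 3))))

cubes≈jacobiSeries[mod] : ∀ n → Gaussian⁷.pochhammer n ^ 3 *S pochhammer n ^ 3 ≈ jacobiSeries 7 *S jacobiSeries 1 [mod q ^ suc n ]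
cubes≈jacobiSeries[mod] n = [mod]-* ([mod]-^-weaken q (ℕP.m≤n*m (suc n) 7) (pochhammer³-[mod]-q^ 7 n))
  ([mod]-^-weaken q (ℕP.≤-reflexive (≡.sym (ℕP.*-identityˡ (suc n))))
    ([mod]-resp (^-congˡ 3 (pochhammer-cong n (*-identityʳ q))) ≈-refl (pochhammer³-[mod]-q^ 1 n)))

-- The congruence also holds for n = 0.
mainTheorem11 : (n : ℕ) → 1 ≤ n → (+ 7) ∣ (τ (suc n) - rhsSum n)
mainTheorem11 n _ = ∣⇒∣ᵤ (divides h (begin
  τ (suc n) - rhsSum n
    ≡⟨ cong (_- rhsSum n) (coeff (difference mod7) n) ⟩
  (cubes +S constS (+ 7) *S quotient mod7) n - rhsSum n
    ≡⟨ cong (_- rhsSum n) (+S-coeff cubes _ n) ⟩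
  cubes n + (constS (+ 7) *S quotient mod7) n - rhsSum n
    ≡⟨ cong₂ (λ u v → u + v - rhsSum n) jacobi (constS*S-coeff (+ 7) (quotient mod7) n) ⟩
  rhsSum n + + 7 * h - rhsSum n
    ≡⟨ cancel (rhsSum n) h ⟩
  h * + 7
    ∎))
  where
  open ≡.≡-Reasoning
  cubes : Series
  cubes = Gaussian⁷.pochhammer n ^ 3 *S pochhammer n ^ 3
  mod7 : etaProd n ≈ cubes [mod constS (+ 7) ]
  mod7 = etaProd≈cubes[mod7] n
  h : ℤ
  h = quotient mod7 n
  jacobi : cubes n ≡ rhsSum n
  jacobi = ≡.trans ([mod]q^⇒coeff (suc n) (cubes≈jacobiSeries[mod] n) n (ℕP.n<1+n n)) (jacobiSeries-convolution n)
  cancel : ∀ a h → a + + 7 * h - a ≡ h * + 7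
  cancel = solve-∀
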